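{- Let $T$ be a tree with a longest path $P=v_1\cdots v_k$ (on $k$ vertices) such that every vertex of $P$ has degree at most $3$ in $T$, and every vertex of $P$ of degree $3$ is incident to a pendant edge. Then $T$ is well-indumatched if and only if $k\in\{1,2,3,4\}$, or $k=7$ and $d(v_4)=2$.
   Context: All graphs are finite, simple and undirected. An induced matching of a graph $G$ is a set $M$ of edges, no two sharing an endpoint, such that no edge of $G$ joins an endpoint of one edge of $M$ to an endpoint of another edge of $M$. A graph is well-indumatched if all of its inclusion-wise maximal induced matchings have the same size. A pendant edge is an edge incident with a vertex of degree $1$. $d(v)$ denotes the degree of $v$. -}

module Defs where

open import Data.Nat using (ℕ; zero; suc; _≤_; _<_; _<ᵇ_)
open import Data.Fin using (Fin; toℕ; fromℕ) renaming (zero to fzero)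
open import Data.Bool using (Bool; true; false; _∧_)
open import Data.List using (List; length; filterᵇ; allFin; cartesianProduct)
open import Data.Sum using (_⊎_)
open import Data.Product using (Σ; ∃; ∃-syntax; _×_; _,_)
open import Relation.Binary.PropositionalEquality using (_≡_; _≢_)
open import Relation.Nullary using (¬_)
open import Function.Definitions using (Injective)

record Graph (n : ℕ) : Set where
  field
    adj     : Fin n → Fin n → Bool
    adj-sym : ∀ u v → adj u v ≡ adj v u
    irrefl  : ∀ v → adj v v ≡ false
open Graph public

module _ {n : ℕ} (G : Graph n) where

  deg : Fin n → ℕ
  deg v = length (filterᵇ (adj G v) (allFin n))

  IsPendantEdge : Fin n → Fin n → Set
  IsPendantEdge u v = adj G u v ≡ true × (deg u ≡ 1 ⊎ deg v ≡ 1)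

  IsPath : (k : ℕ) → (Fin k → Fin n) → Set
  IsPath k p = Injective _≡_ _≡_ p
             × (∀ (i j : Fin k) → toℕ j ≡ suc (toℕ i) → adj G (p i) (p j) ≡ true)

  Connected : Set
  Connected = ∀ (u v : Fin n) → ∃[ m ] Σ (Fin (suc m) → Fin n) λ p →
                IsPath (suc m) p × p fzero ≡ u × p (fromℕ m) ≡ v

  HasCycle : Set
  HasCycle = ∃[ m ] Σ (Fin (suc m) → Fin n) λ p →
               2 ≤ m × IsPath (suc m) p × adj G (p fzero) (p (fromℕ m)) ≡ true

  IsTree : Set
  IsTree = 1 ≤ n × Connected × ¬ HasCycle

  IsLongestPath : (k : ℕ) → (Fin k → Fin n) → Set
  IsLongestPath k p = IsPath k p × (∀ (m : ℕ) (q : Fin m → Fin n) → IsPath m q → m ≤ k)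

  -- edge sets, represented as symmetric Boolean relations
  EdgeSet : Set
  EdgeSet = Fin n → Fin n → Bool

  _⊆ₑ_ : EdgeSet → EdgeSet → Set
  M ⊆ₑ M' = ∀ u v → M u v ≡ true → M' u v ≡ true

  size : EdgeSet → ℕ
  size M = length (filterᵇ (λ { (u , v) → (toℕ u <ᵇ toℕ v) ∧ M u v })
                           (cartesianProduct (allFin n) (allFin n)))

  IsInducedMatching : EdgeSet → Set
  IsInducedMatching M =
      (∀ u v → M u v ≡ M v u)
    × (∀ u v → M u v ≡ true → adj G u v ≡ true)
    × (∀ u v x y → M u v ≡ true → M x y ≡ true →
         ¬ (u ≡ x × v ≡ y) → ¬ (u ≡ y × v ≡ x) →
           (u ≢ x × u ≢ y × v ≢ x × v ≢ y)
         × (adj G u x ≡ false × adj G u y ≡ false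
            × adj G v x ≡ false × adj G v y ≡ false))

  IsMaximalInducedMatching : EdgeSet → Set
  IsMaximalInducedMatching M =
    IsInducedMatching M × (∀ M' → IsInducedMatching M' → M ⊆ₑ M' → M' ⊆ₑ M)

  WellIndumatched : Set
  WellIndumatched = ∀ M M' → IsMaximalInducedMatching M →
                      IsMaximalInducedMatching M' → size M ≡ size M'

module Submission where

-- Write P = v₀ v₁ … v_K, so k = K + 1. If a vertex off P is adjacent to a vertex off P adjacent to
-- v_a, then extending P shows 2 ≤ a ≤ K − 2, and v_a would have three neighbours of degree at least 2
-- besides its pendant edge. So every vertex off P is a leaf hanging at an inner vertex of P.
-- If k ≤ 4, every edge meets the middle vertex or edge of P, so every maximal induced matching has
-- one edge. If k = 7 and d(v₃) = 2, every edge meets exactly one of v₁v₂ and v₄v₅, and every maximal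
-- induced matching has two edges. Otherwise take a maximal induced matching through v₀v₁ and v₃v₄
-- (and v₆v₇ if k ≥ 8) and trade these two edges for v₂v₃; or, if k = 7 and v₃ has a leaf ℓ, take one
-- through v₀v₁, v₃ℓ and v₅v₆ and trade these for v₁v₂ and v₄v₅. The result is still maximal, with
-- one edge fewer.

open import Defs
open import Data.Nat using (ℕ; zero; suc; _≤_; _<_; _<ᵇ_; _<?_; z≤n; s≤s; _+_; _∸_)
open import Data.Nat.Properties
  using (≤-refl; ≤-trans; ≤-pred; <-trans; ≤-<-trans; <⇒<ᵇ; <ᵇ⇒<; <⇒≯; <-cmp; n<1+n; +-suc; +-identityʳ; m≤n+m;
         m≤n⇒m≤1+n; 1+n≰n; +-cancelˡ-≡; +-monoʳ-<; +-∸-assoc; ∸-cancelˡ-≡; m∸n≤m;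
         n≤1+n; ∸-monoˡ-≤; m+[n∸m]≡n; m+n∸n≡m; m≤n⇒m<n∨m≡n; ≤-antisym; <⇒≢; n∸n≡0; +-monoʳ-≤; 1+n≢n)
open import Data.Fin using (Fin; toℕ; fromℕ; fromℕ<) renaming (zero to fzero; _≟_ to _≟ᶠ_)
open import Data.Fin.Properties using (toℕ-injective; toℕ<n; toℕ-fromℕ; toℕ-fromℕ<; fromℕ<-toℕ; any?; all?)
open import Data.Bool using (Bool; true; false; _∧_; _∨_; not) renaming (T to True)
open import Data.Bool.Properties using (T-≡; ∧-zeroʳ; ∧-identityʳ; ∨-zeroʳ; ∨-identityʳ) renaming (_≟_ to _≟ᵇ_)
open import Data.List using (List; []; _∷_; length; filterᵇ; allFin; cartesianProduct)
open import Data.List.Membership.Propositional using (_∈_)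
open import Data.List.Membership.Propositional.Properties using (∈-allFin; ∈-cartesianProduct⁺)
open import Data.List.Relation.Unary.Any using (Any; here; there)
open import Data.List.Relation.Unary.All as All using (All; []; _∷_)
open import Data.List.Relation.Unary.AllPairs using (AllPairs; []; _∷_)
open import Data.List.Relation.Unary.Unique.Propositional using (Unique)
open import Data.List.Relation.Unary.Unique.Propositional.Properties using (allFin⁺; cartesianProduct⁺)
open import Data.Sum using (_⊎_; inj₁; inj₂; [_,_]′; map₂)
open import Data.Product using (Σ; ∃-syntax; _×_; _,_; proj₁; proj₂)
open import Data.Empty using (⊥; ⊥-elim)
open import Relation.Nullary using (¬_; Dec; yes; no; does)
open import Relation.Nullary.Decidable using (_×-dec_; _⊎-dec_; _→-dec_; ¬?; dec-true; dec-false)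
open import Relation.Binary.Definitions using (tri<; tri≈; tri>)
open import Relation.Binary.PropositionalEquality
open import Function.Bundles using (Equivalence; _⇔_; mk⇔)
open import Function.Base using (_∘_)

false≢true : ∀ {b} → b ≡ false → b ≡ true → ⊥
false≢true refl ()

count : {A : Set} → (A → Bool) → List A → ℕ
count f xs = length (filterᵇ f xs)

count-cong : {A : Set} (f g : A → Bool) (xs : List A) → (∀ x → x ∈ xs → f x ≡ g x) → count f xs ≡ count g xs
count-cong f g [] h = refl
count-cong f g (x ∷ xs) h with f x | g x | h x (here refl)
... | true  | true  | _ = cong suc (count-cong f g xs (λ y m → h y (there m)))
... | false | false | _ = count-cong f g xs (λ y m → h y (there m))

count-const-false : {A : Set} (f : A → Bool) (xs : List A) → (∀ x → f x ≡ false) → count f xs ≡ 0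
count-const-false f [] h = refl
count-const-false f (x ∷ xs) h rewrite h x = count-const-false f xs h

count≤length : {A : Set} (f : A → Bool) (xs : List A) → count f xs ≤ length xs
count≤length f [] = z≤n
count≤length f (x ∷ xs) with f x
... | true  = s≤s (count≤length f xs)
... | false = m≤n⇒m≤1+n (count≤length f xs)

count-drop : {A : Set} (f g : A → Bool) (xs : List A) (c : A) → Unique xs → c ∈ xs →
  f c ≡ true → g c ≡ false → (∀ x → x ≢ c → g x ≡ f x) → count f xs ≡ suc (count g xs)
count-drop f g (x ∷ xs) .x (x∉xs ∷ _) (here refl) fc gc h rewrite fc | gc =
  cong suc (count-cong f g xs (λ y y∈xs → sym (h y (λ y≡x → All.lookup x∉xs y∈xs (sym y≡x)))))
count-drop f g (x ∷ xs) c (x∉xs ∷ u) (there c∈xs) fc gc h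
  with f x | h x (λ x≡c → All.lookup x∉xs c∈xs x≡c)
... | true  | gx rewrite gx = cong suc (count-drop f g xs c u c∈xs fc gc h)
... | false | gx rewrite gx = count-drop f g xs c u c∈xs fc gc h

length≤count : {A : Set} (_≟_ : (x y : A) → Dec (x ≡ y)) (f : A → Bool) (xs : List A) → Unique xs →
  (ys : List A) → Unique ys → All (_∈ xs) ys → All (λ y → f y ≡ true) ys → length ys ≤ count f xs
length≤count _≟_ f xs uxs [] _ _ _ = z≤n
length≤count _≟_ f xs uxs (y ∷ ys) (y∉ys ∷ uys) (y∈xs ∷ ys⊆xs) (fy ∷ fys) =
  subst (suc (length ys) ≤_) (sym (count-drop f g xs y uxs y∈xs fy gy g≗f))
    (s≤s (length≤count _≟_ g xs uxs ys uys ys⊆xs (gys ys y∉ys fys)))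
  where
    g : _ → Bool
    g x = f x ∧ not (does (x ≟ y))
    gy : g y ≡ false
    gy with y ≟ y
    ... | yes _ = ∧-zeroʳ (f y)
    ... | no y≢y = ⊥-elim (y≢y refl)
    g≗f : ∀ x → x ≢ y → g x ≡ f x
    g≗f x x≢y with x ≟ y
    ... | yes x≡y = ⊥-elim (x≢y x≡y)
    ... | no _ = ∧-identityʳ (f x)
    gys : ∀ zs → All (y ≢_) zs → All (λ z → f z ≡ true) zs → All (λ z → g z ≡ true) zs
    gys [] _ _ = []
    gys (z ∷ zs) (y≢z ∷ y∉zs) (fz ∷ fzs) = trans (g≗f z (λ z≡y → y≢z (sym z≡y))) fz ∷ gys zs y∉zs fzs

module _ {n : ℕ} (G : Graph n) where

  adj-flip : ∀ {u v} → adj G u v ≡ true → adj G v u ≡ true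
  adj-flip {u} {v} = trans (adj-sym G v u)

  SameEdge : Fin n → Fin n → Fin n → Fin n → Set
  SameEdge u v a b = (u ≡ a × v ≡ b) ⊎ (u ≡ b × v ≡ a)

  sameEdge? : ∀ u v a b → Dec (SameEdge u v a b)
  sameEdge? u v a b = (u ≟ᶠ a ×-dec v ≟ᶠ b) ⊎-dec (u ≟ᶠ b ×-dec v ≟ᶠ a)

  sameEdge-swapˡ : ∀ {u v a b} → SameEdge u v a b → SameEdge v u a b
  sameEdge-swapˡ (inj₁ (p , q)) = inj₂ (q , p)
  sameEdge-swapˡ (inj₂ (p , q)) = inj₁ (q , p)

  sameEdge-swapʳ : ∀ {u v a b} → SameEdge u v a b → SameEdge u v b a
  sameEdge-swapʳ (inj₁ (p , q)) = inj₂ (p , q)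
  sameEdge-swapʳ (inj₂ (p , q)) = inj₁ (p , q)

  ⟦_,_⟧ : Fin n → Fin n → EdgeSet G
  ⟦ a , b ⟧ u v = does (sameEdge? u v a b)

  ⟦⟧-true : ∀ a b u v → SameEdge u v a b → ⟦ a , b ⟧ u v ≡ true
  ⟦⟧-true a b u v = dec-true (sameEdge? u v a b)

  ⟦⟧-false : ∀ a b u v → ¬ SameEdge u v a b → ⟦ a , b ⟧ u v ≡ false
  ⟦⟧-false a b u v = dec-false (sameEdge? u v a b)

  ⟦⟧-self : ∀ a b → ⟦ a , b ⟧ a b ≡ true
  ⟦⟧-self a b = ⟦⟧-true a b a b (inj₁ (refl , refl))

  ⟦⟧-sound : ∀ {a b u v} → ⟦ a , b ⟧ u v ≡ true → SameEdge u v a b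
  ⟦⟧-sound {a} {b} {u} {v} = witness (sameEdge? u v a b)
    where
      witness : (d : Dec (SameEdge u v a b)) → does d ≡ true → SameEdge u v a b
      witness (yes s) _ = s

  ⟦⟧-cong : ∀ a b u v c d x y → (SameEdge u v a b → SameEdge x y c d) → (SameEdge x y c d → SameEdge u v a b) →
    ⟦ a , b ⟧ u v ≡ ⟦ c , d ⟧ x y
  ⟦⟧-cong a b u v c d x y f g with sameEdge? u v a b
  ... | yes s = trans (⟦⟧-true a b u v s) (sym (⟦⟧-true c d x y (f s)))
  ... | no ¬s = trans (⟦⟧-false a b u v ¬s) (sym (⟦⟧-false c d x y (λ t → ¬s (g t))))

  ⟦⟧-sym : ∀ a b u v → ⟦ a , b ⟧ u v ≡ ⟦ a , b ⟧ v u
  ⟦⟧-sym a b u v = ⟦⟧-cong a b u v a b v u sameEdge-swapˡ sameEdge-swapˡ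

  ⟦⟧-comm : ∀ a b u v → ⟦ a , b ⟧ u v ≡ ⟦ b , a ⟧ u v
  ⟦⟧-comm a b u v = ⟦⟧-cong a b u v b a u v sameEdge-swapʳ sameEdge-swapʳ

  ∅ₑ : EdgeSet G
  ∅ₑ _ _ = false

  remove : EdgeSet G → Fin n → Fin n → EdgeSet G
  remove M a b u v = M u v ∧ not (⟦ a , b ⟧ u v)

  insert : EdgeSet G → Fin n → Fin n → EdgeSet G
  insert M a b u v = M u v ∨ ⟦ a , b ⟧ u v

  Symmetric : EdgeSet G → Set
  Symmetric M = ∀ u v → M u v ≡ M v u

  remove-sym : ∀ {M} a b → Symmetric M → Symmetric (remove M a b)
  remove-sym a b s u v = cong₂ (λ x y → x ∧ not y) (s u v) (⟦⟧-sym a b u v)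

  insert-sym : ∀ {M} a b → Symmetric M → Symmetric (insert M a b)
  insert-sym a b s u v = cong₂ _∨_ (s u v) (⟦⟧-sym a b u v)

  remove-⊆ : ∀ M a b → _⊆ₑ_ G (remove M a b) M
  remove-⊆ M a b u v e with M u v
  ... | true = refl

  remove-≢ : ∀ M a b u v → remove M a b u v ≡ true → ¬ SameEdge u v a b
  remove-≢ M a b u v e s rewrite ⟦⟧-true a b u v s = false≢true (∧-zeroʳ (M u v)) e

  remove-keeps : ∀ M a b u v → M u v ≡ true → ¬ SameEdge u v a b → remove M a b u v ≡ true
  remove-keeps M a b u v m ¬s rewrite m | ⟦⟧-false a b u v ¬s = refl

  insert-new : ∀ M a b → insert M a b a b ≡ true
  insert-new M a b rewrite ⟦⟧-self a b = ∨-zeroʳ _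

  insert-⊇ : ∀ M a b → _⊆ₑ_ G M (insert M a b)
  insert-⊇ M a b u v m rewrite m = refl

  insert-cases : ∀ M a b u v → insert M a b u v ≡ true → M u v ≡ true ⊎ SameEdge u v a b
  insert-cases M a b u v e with M u v
  ... | true = inj₁ refl
  ... | false = inj₂ (⟦⟧-sound e)

  Far : Fin n → Fin n → Set
  Far x y = x ≢ y × adj G x y ≡ false

  far-sym : ∀ {x y} → Far x y → Far y x
  far-sym (x≢y , xy∉G) = (λ y≡x → x≢y (sym y≡x)) , trans (adj-sym G _ _) xy∉G

  Separated : Fin n → Fin n → Fin n → Fin n → Set
  Separated u v x y = (u ≢ x × u ≢ y × v ≢ x × v ≢ y)
                    × (adj G u x ≡ false × adj G u y ≡ false × adj G v x ≡ false × adj G v y ≡ false)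

  separated : ∀ {u v x y} → Far u x → Far u y → Far v x → Far v y → Separated u v x y
  separated (a₁ , b₁) (a₂ , b₂) (a₃ , b₃) (a₄ , b₄) = (a₁ , a₂ , a₃ , a₄) , (b₁ , b₂ , b₃ , b₄)

  separated⇒far : ∀ {u v x y} → Separated u v x y → Far u x × Far u y × Far v x × Far v y
  separated⇒far ((a₁ , a₂ , a₃ , a₄) , (b₁ , b₂ , b₃ , b₄)) = (a₁ , b₁) , (a₂ , b₂) , (a₃ , b₃) , (a₄ , b₄)

  separated? : ∀ u v x y → Dec (Separated u v x y)
  separated? u v x y = (¬? (u ≟ᶠ x) ×-dec ¬? (u ≟ᶠ y) ×-dec ¬? (v ≟ᶠ x) ×-dec ¬? (v ≟ᶠ y))
    ×-dec (adj G u x ≟ᵇ false ×-dec adj G u y ≟ᵇ false ×-dec adj G v x ≟ᵇ false ×-dec adj G v y ≟ᵇ false)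

  separated-swap : ∀ {u v x y} → Separated u v x y → Separated v u x y
  separated-swap ((a , b , c , d) , (e , f , g , h)) = (c , d , a , b) , (g , h , e , f)

  separated-sym : ∀ {u v x y} → Separated u v x y → Separated x y u v
  separated-sym ((a , b , c , d) , (e , f , g , h)) =
    ((λ z → a (sym z)) , (λ z → c (sym z)) , (λ z → b (sym z)) , (λ z → d (sym z))) ,
    (trans (adj-sym G _ _) e , trans (adj-sym G _ _) g , trans (adj-sym G _ _) f , trans (adj-sym G _ _) h)

  separated-sameEdge : ∀ {u v a b x y} → SameEdge u v a b → Separated a b x y → Separated u v x y
  separated-sameEdge (inj₁ (refl , refl)) s = s
  separated-sameEdge (inj₂ (refl , refl)) s = separated-swap s

  Near : Fin n → Fin n → Fin n → Set
  Near z x y = z ≡ x ⊎ z ≡ y ⊎ adj G z x ≡ true ⊎ adj G z y ≡ true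

  pattern is-left e = inj₁ e
  pattern is-right e = inj₂ (inj₁ e)
  pattern adj-left e = inj₂ (inj₂ (inj₁ e))
  pattern adj-right e = inj₂ (inj₂ (inj₂ e))

  Conflict : Fin n → Fin n → Fin n → Fin n → Set
  Conflict u v x y = Near u x y ⊎ Near v x y

  near-sameEdge : ∀ {z x y a b} → Near z x y → SameEdge x y a b → Near z a b
  near-sameEdge q (inj₁ (refl , refl)) = q
  near-sameEdge (is-left q) (inj₂ (refl , refl)) = is-right q
  near-sameEdge (is-right q) (inj₂ (refl , refl)) = is-left q
  near-sameEdge (adj-left q) (inj₂ (refl , refl)) = adj-right q
  near-sameEdge (adj-right q) (inj₂ (refl , refl)) = adj-left q

  conflict-sameEdge : ∀ {u v x y a b} → Conflict u v x y → SameEdge x y a b → Conflict u v a b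
  conflict-sameEdge (inj₁ q) s = inj₁ (near-sameEdge q s)
  conflict-sameEdge (inj₂ q) s = inj₂ (near-sameEdge q s)

  conflict⇒¬separated : ∀ {u v x y} → Conflict u v x y → ¬ Separated u v x y
  conflict⇒¬separated (inj₁ (is-left e)) ((a , _ , _ , _) , _) = a e
  conflict⇒¬separated (inj₁ (is-right e)) ((_ , b , _ , _) , _) = b e
  conflict⇒¬separated (inj₁ (adj-left e)) (_ , (a , _ , _ , _)) = false≢true a e
  conflict⇒¬separated (inj₁ (adj-right e)) (_ , (_ , b , _ , _)) = false≢true b e
  conflict⇒¬separated (inj₂ (is-left e)) ((_ , _ , c , _) , _) = c e
  conflict⇒¬separated (inj₂ (is-right e)) ((_ , _ , _ , d) , _) = d e
  conflict⇒¬separated (inj₂ (adj-left e)) (_ , (_ , _ , c , _)) = false≢true c e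
  conflict⇒¬separated (inj₂ (adj-right e)) (_ , (_ , _ , _ , d)) = false≢true d e

  ¬separated⇒conflict : ∀ u v x y → ¬ Separated u v x y → Conflict u v x y
  ¬separated⇒conflict u v x y ¬s
    with u ≟ᶠ x | u ≟ᶠ y | v ≟ᶠ x | v ≟ᶠ y | adj G u x in e₁ | adj G u y in e₂ | adj G v x in e₃ | adj G v y in e₄
  ... | yes p | _ | _ | _ | _ | _ | _ | _ = inj₁ (is-left p)
  ... | no _ | yes p | _ | _ | _ | _ | _ | _ = inj₁ (is-right p)
  ... | no _ | no _ | yes p | _ | _ | _ | _ | _ = inj₂ (is-left p)
  ... | no _ | no _ | no _ | yes p | _ | _ | _ | _ = inj₂ (is-right p)
  ... | no _ | no _ | no _ | no _ | true | _ | _ | _ = inj₁ (adj-left refl)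
  ... | no _ | no _ | no _ | no _ | false | true | _ | _ = inj₁ (adj-right refl)
  ... | no _ | no _ | no _ | no _ | false | false | true | _ = inj₂ (adj-left refl)
  ... | no _ | no _ | no _ | no _ | false | false | false | true = inj₂ (adj-right refl)
  ... | no a | no b | no c | no d | false | false | false | false = ⊥-elim (¬s ((a , b , c , d) , refl , refl , refl , refl))

  adj⇒≢ : ∀ {u v} → adj G u v ≡ true → u ≢ v
  adj⇒≢ {u} e refl = false≢true (irrefl G u) e

  module _ {M : EdgeSet G} (im : IsInducedMatching G M) where

    IM-sym : Symmetric M
    IM-sym = proj₁ im

    IM-adj : ∀ {x y} → M x y ≡ true → adj G x y ≡ true
    IM-adj {x} {y} = proj₁ (proj₂ im) x y

    IM-separated : ∀ {x y a b} → M x y ≡ true → M a b ≡ true → ¬ SameEdge x y a b → Separated x y a b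
    IM-separated {x} {y} {a} {b} mxy mab ¬s = proj₂ (proj₂ im) x y a b mxy mab (λ z → ¬s (inj₁ z)) (λ z → ¬s (inj₂ z))

    IM-conflict⇒sameEdge : ∀ {x y a b} → M x y ≡ true → M a b ≡ true → Conflict x y a b → SameEdge x y a b
    IM-conflict⇒sameEdge {x} {y} {a} {b} mxy mab c with sameEdge? x y a b
    ... | yes s = s
    ... | no ¬s = ⊥-elim (conflict⇒¬separated c (IM-separated mxy mab ¬s))

    IM-≢⇒∉ : ∀ {a b c} → M a c ≡ true → b ≢ c → M a b ≡ false
    IM-≢⇒∉ {a} {b} {c} ac∈M b≢c with M a b in e
    ... | false = refl
    ... | true = ⊥-elim (proj₁ (proj₁ (IM-separated e ac∈M ≠)) refl)
      where
        ≠ : ¬ SameEdge a b a c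
        ≠ (inj₁ (_ , b≡c)) = b≢c b≡c
        ≠ (inj₂ (a≡c , b≡a)) = b≢c (trans b≡a a≡c)

    IM-⊆ : ∀ {M′} → Symmetric M′ → _⊆ₑ_ G M′ M → IsInducedMatching G M′
    IM-⊆ s′ sub = s′ , (λ u v m → IM-adj (sub u v m)) , (λ u v x y m₁ m₂ → proj₂ (proj₂ im) u v x y (sub u v m₁) (sub x y m₂))

    IM-insert : ∀ {a b} → adj G a b ≡ true → (∀ x y → M x y ≡ true → Separated a b x y) →
      IsInducedMatching G (insert M a b)
    IM-insert {a} {b} ab∈G sep = insert-sym a b IM-sym , adjacent , separated′
      where
        adjacent : ∀ u v → insert M a b u v ≡ true → adj G u v ≡ true
        adjacent u v m with insert-cases M a b u v m
        ... | inj₁ m′ = IM-adj m′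
        ... | inj₂ (inj₁ (refl , refl)) = ab∈G
        ... | inj₂ (inj₂ (refl , refl)) = adj-flip ab∈G
        separated′ : ∀ u v x y → insert M a b u v ≡ true → insert M a b x y ≡ true →
          ¬ (u ≡ x × v ≡ y) → ¬ (u ≡ y × v ≡ x) → Separated u v x y
        separated′ u v x y m₁ m₂ n₁ n₂ with insert-cases M a b u v m₁ | insert-cases M a b x y m₂
        ... | inj₁ p | inj₁ q = proj₂ (proj₂ im) u v x y p q n₁ n₂
        ... | inj₁ p | inj₂ s = separated-sym (separated-sameEdge s (sep u v p))
        ... | inj₂ s | inj₁ q = separated-sameEdge s (sep x y q)
        ... | inj₂ (inj₁ (refl , refl)) | inj₂ (inj₁ (refl , refl)) = ⊥-elim (n₁ (refl , refl))
        ... | inj₂ (inj₁ (refl , refl)) | inj₂ (inj₂ (refl , refl)) = ⊥-elim (n₂ (refl , refl))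
        ... | inj₂ (inj₂ (refl , refl)) | inj₂ (inj₁ (refl , refl)) = ⊥-elim (n₂ (refl , refl))
        ... | inj₂ (inj₂ (refl , refl)) | inj₂ (inj₂ (refl , refl)) = ⊥-elim (n₁ (refl , refl))

  IM-∅ : IsInducedMatching G ∅ₑ
  IM-∅ = (λ _ _ → refl) , (λ _ _ ()) , (λ _ _ _ _ ())

  private
    pairs : List (Fin n × Fin n)
    pairs = cartesianProduct (allFin n) (allFin n)

    pairs-unique : Unique pairs
    pairs-unique = cartesianProduct⁺ (allFin⁺ n) (allFin⁺ n)

    <ᵇ-asym : ∀ {i j} → j < i → (i <ᵇ j) ≡ false
    <ᵇ-asym {i} {j} j<i with i <ᵇ j in e
    ... | false = refl
    ... | true = ⊥-elim (<⇒≯ j<i (<ᵇ⇒< i j (subst True (sym e) _)))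

  size-cong : ∀ M M′ → (∀ u v → M u v ≡ M′ u v) → size G M ≡ size G M′
  size-cong M M′ h = count-cong _ _ pairs (λ { (u , v) _ → cong ((toℕ u <ᵇ toℕ v) ∧_) (h u v) })

  size-empty : ∀ M → (∀ u v → M u v ≡ false) → size G M ≡ 0
  size-empty M h = count-const-false _ pairs (λ { (u , v) → trans (cong ((toℕ u <ᵇ toℕ v) ∧_) (h u v)) (∧-zeroʳ _) })

  size≤ : ∀ M → size G M ≤ length pairs
  size≤ M = count≤length _ pairs

  private
    size-remove< : ∀ M a b → M a b ≡ true → toℕ a < toℕ b → size G M ≡ suc (size G (remove M a b))
    size-remove< M a b mab a<b =
      count-drop _ _ pairs (a , b) pairs-unique (∈-cartesianProduct⁺ (∈-allFin a) (∈-allFin b)) counted dropped unchanged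
      where
        counted : ((toℕ a <ᵇ toℕ b) ∧ M a b) ≡ true
        counted rewrite Equivalence.to T-≡ (<⇒<ᵇ a<b) | mab = refl
        dropped : ((toℕ a <ᵇ toℕ b) ∧ remove M a b a b) ≡ false
        dropped rewrite ⟦⟧-self a b | ∧-zeroʳ (M a b) = ∧-zeroʳ _
        unchanged′ : ∀ u v → (u , v) ≢ (a , b) →
          ((toℕ u <ᵇ toℕ v) ∧ remove M a b u v) ≡ ((toℕ u <ᵇ toℕ v) ∧ M u v)
        unchanged′ u v uv≢ab with sameEdge? u v a b
        ... | yes (inj₁ (refl , refl)) = ⊥-elim (uv≢ab refl)
        ... | yes (inj₂ (refl , refl)) rewrite <ᵇ-asym a<b = refl
        ... | no ¬s rewrite ⟦⟧-false a b u v ¬s | ∧-identityʳ (M u v) = refl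
        unchanged : ∀ x → x ≢ (a , b) → _
        unchanged (u , v) = unchanged′ u v

  size-remove : ∀ M a b → Symmetric M → M a b ≡ true → a ≢ b → size G M ≡ suc (size G (remove M a b))
  size-remove M a b s mab a≢b with <-cmp (toℕ a) (toℕ b)
  ... | tri< a<b _ _ = size-remove< M a b mab a<b
  ... | tri≈ _ a≡b _ = ⊥-elim (a≢b (toℕ-injective a≡b))
  ... | tri> _ _ b<a = trans (size-remove< M b a (trans (s b a) mab) b<a)
                         (cong suc (size-cong _ _ (λ u v → cong (λ z → M u v ∧ not z) (⟦⟧-comm b a u v))))

  size-insert : ∀ M a b → Symmetric M → M a b ≡ false → a ≢ b → size G (insert M a b) ≡ suc (size G M)
  size-insert M a b s mab a≢b =
    trans (size-remove (insert M a b) a b (insert-sym a b s) (insert-new M a b) a≢b) (cong suc (size-cong _ _ restore))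
    where
      restore : ∀ u v → remove (insert M a b) a b u v ≡ M u v
      restore u v with sameEdge? u v a b
      ... | yes (inj₁ (refl , refl)) rewrite ⟦⟧-self u v | ∨-zeroʳ (M u v) = sym mab
      ... | yes (inj₂ (refl , refl)) rewrite ⟦⟧-true v u u v (inj₂ (refl , refl)) | ∨-zeroʳ (M u v) = sym (trans (s u v) mab)
      ... | no ¬s rewrite ⟦⟧-false a b u v ¬s | ∨-identityʳ (M u v) = ∧-identityʳ _

  ConflictsWith : EdgeSet G → Fin n → Fin n → Set
  ConflictsWith M u v = Σ (Fin n) λ x → Σ (Fin n) λ y → M x y ≡ true × Conflict u v x y

  Dominating : EdgeSet G → Set
  Dominating M = ∀ u v → adj G u v ≡ true → M u v ≡ true ⊎ ConflictsWith M u v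

  maximal-if-dominating : ∀ {M} → IsInducedMatching G M → Dominating M → IsMaximalInducedMatching G M
  maximal-if-dominating {M} im dom = im , maximal
    where
      maximal : ∀ M′ → IsInducedMatching G M′ → _⊆ₑ_ G M M′ → _⊆ₑ_ G M′ M
      maximal M′ (_ , adj′ , sep′) M⊆M′ u v m′ with M u v in e
      ... | true = refl
      ... | false with dom u v (adj′ u v m′)
      ...   | inj₁ m = ⊥-elim (false≢true e m)
      ...   | inj₂ (x , y , mxy , c) = ⊥-elim (conflict⇒¬separated c (sep′ u v x y m′ (M⊆M′ x y mxy) n₁ n₂))
        where
          n₁ : ¬ (u ≡ x × v ≡ y)
          n₁ (refl , refl) = false≢true e mxy
          n₂ : ¬ (u ≡ y × v ≡ x)
          n₂ (refl , refl) = false≢true e (trans (IM-sym im _ _) mxy)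

  private
    allSeparated? : ∀ (M : EdgeSet G) u v → Dec (∀ x y → M x y ≡ true → Separated u v x y)
    allSeparated? M u v =
      all? {P = λ x → ∀ y → M x y ≡ true → Separated u v x y} λ x →
      all? {P = λ y → M x y ≡ true → Separated u v x y} λ y → (M x y ≟ᵇ true) →-dec separated? u v x y

    conflictsWith-if-¬allSeparated : ∀ (M : EdgeSet G) u v → ¬ (∀ x y → M x y ≡ true → Separated u v x y) →
        ConflictsWith M u v
    conflictsWith-if-¬allSeparated M u v ¬all
      with any? {P = λ x → Σ (Fin n) λ y → M x y ≡ true × ¬ Separated u v x y} (λ x →
           any? {P = λ y → M x y ≡ true × ¬ Separated u v x y} λ y → (M x y ≟ᵇ true) ×-dec ¬? (separated? u v x y))
    ... | yes (x , y , m , ¬s) = x , y , m , ¬separated⇒conflict u v x y ¬s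
    ... | no ¬any = ⊥-elim (¬all all)
      where
        all : ∀ x y → M x y ≡ true → Separated u v x y
        all x y m with separated? u v x y
        ... | yes s = s
        ... | no ¬s = ⊥-elim (¬any (x , y , m , ¬s))

  dominating-if-maximal : ∀ {M} → IsMaximalInducedMatching G M → Dominating M
  dominating-if-maximal {M} (im , maximal) u v uv∈G with M u v in e
  ... | true = inj₁ refl
  ... | false with allSeparated? M u v
  ...   | yes sep = ⊥-elim
        (false≢true e (maximal (insert M u v) (IM-insert im uv∈G sep) (insert-⊇ M u v) u v (insert-new M u v)))
  ...   | no ¬sep = inj₂ (conflictsWith-if-¬allSeparated M u v ¬sep)

  Addable : EdgeSet G → Set
  Addable M = Σ (Fin n) λ u → Σ (Fin n) λ v →
    adj G u v ≡ true × M u v ≡ false × (∀ x y → M x y ≡ true → Separated u v x y)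

  extend-to-maximal : ∀ M → IsInducedMatching G M → Σ (EdgeSet G) λ N → IsMaximalInducedMatching G N × _⊆ₑ_ G M N
  extend-to-maximal M im = go (length pairs) M im (m≤n+m (length pairs) (size G M))
    where
      addable? : ∀ (M : EdgeSet G) → Dec (Addable M)
      addable? M =
        any? {P = λ u → Σ (Fin n) λ v → adj G u v ≡ true × M u v ≡ false × (∀ x y → M x y ≡ true → Separated u v x y)} λ u →
        any? {P = λ v → adj G u v ≡ true × M u v ≡ false × (∀ x y → M x y ≡ true → Separated u v x y)} λ v →
        (adj G u v ≟ᵇ true) ×-dec (M u v ≟ᵇ false) ×-dec allSeparated? M u v

      dominating-if-¬addable : ∀ (M : EdgeSet G) → ¬ Addable M → Dominating M
      dominating-if-¬addable M ¬add u v uv∈G with M u v in e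
      ... | true = inj₁ refl
      ... | false = inj₂ (conflictsWith-if-¬allSeparated M u v (λ sep → ¬add (u , v , uv∈G , e , sep)))

      go : ∀ fuel (M : EdgeSet G) → IsInducedMatching G M → length pairs ≤ size G M + fuel →
        Σ (EdgeSet G) λ N → IsMaximalInducedMatching G N × _⊆ₑ_ G M N
      go fuel M im bound with addable? M
      ... | no ¬add = M , maximal-if-dominating im (dominating-if-¬addable M ¬add) , (λ _ _ m → m)
      go zero M im bound | yes (u , v , uv∈G , uv∉M , sep) = ⊥-elim (1+n≰n (begin
          suc (size G M)      ≡⟨ sym (size-insert M u v (IM-sym im) uv∉M (adj⇒≢ uv∈G)) ⟩
          size G (insert M u v) ≤⟨ size≤ (insert M u v) ⟩
          length pairs        ≤⟨ bound ⟩
          size G M + 0        ≡⟨ +-identityʳ (size G M) ⟩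
          size G M            ∎))
        where open Data.Nat.Properties.≤-Reasoning
      go (suc fuel) M im bound | yes (u , v , uv∈G , uv∉M , sep)
        with go fuel (insert M u v) (IM-insert im uv∈G sep)
               (subst (length pairs ≤_)
                 (trans (+-suc (size G M) fuel)
                     (cong (_+ fuel) (sym (size-insert M u v (IM-sym im) uv∉M (adj⇒≢ uv∈G))))) bound)
      ... | N , maxN , sub = N , maxN , (λ x y m → sub x y (insert-⊇ M u v x y m))

  size≡1 : ∀ {M a b} → IsInducedMatching G M → M a b ≡ true → (∀ x y → M x y ≡ true → SameEdge x y a b) → size G M ≡ 1
  size≡1 {M} {a} {b} im mab only = trans (size-remove M a b (IM-sym im) mab (adj⇒≢ (IM-adj im mab)))
      (cong suc (size-empty _ none))
    where
      none : ∀ x y → remove M a b x y ≡ false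
      none x y with M x y in e
      ... | false = refl
      ... | true rewrite ⟦⟧-true a b x y (only x y e) = refl

  size≡2 : ∀ {M a b c d} → IsInducedMatching G M → M a b ≡ true → M c d ≡ true → ¬ SameEdge c d a b →
    (∀ x y → M x y ≡ true → SameEdge x y a b ⊎ SameEdge x y c d) → size G M ≡ 2
  size≡2 {M} {a} {b} {c} {d} im mab mcd cd≠ab only =
    trans (size-remove M a b (IM-sym im) mab (adj⇒≢ (IM-adj im mab)))
      (cong suc (trans (size-remove (remove M a b) c d (remove-sym a b (IM-sym im))
          (remove-keeps M a b c d mcd cd≠ab) (adj⇒≢ (IM-adj im mcd)))
                       (cong suc (size-empty _ none))))
    where
      none : ∀ x y → remove (remove M a b) c d x y ≡ false
      none x y with M x y in e
      ... | false = refl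
      ... | true with only x y e
      ...   | inj₁ s rewrite ⟦⟧-true a b x y s = refl
      ...   | inj₂ s rewrite ⟦⟧-true c d x y s = ∧-zeroʳ _

  In : Fin n → Fin n → Fin n → Set
  In s t z = z ≡ s ⊎ z ≡ t

  Meets : Fin n → Fin n → Fin n → Fin n → Set
  Meets s t x y = In s t x ⊎ In s t y

  Close : Fin n → Fin n → Set
  Close s t = s ≡ t ⊎ adj G s t ≡ true

  meets-swap : ∀ {s t x y} → Meets s t x y → Meets s t y x
  meets-swap (inj₁ i) = inj₂ i
  meets-swap (inj₂ i) = inj₁ i

  meets-sameEdge : ∀ {s t a b c d} → SameEdge c d a b → Meets s t a b → Meets s t c d
  meets-sameEdge (inj₁ (refl , refl)) m = m
  meets-sameEdge (inj₂ (refl , refl)) m = meets-swap m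

  meets-close⇒conflict : ∀ {s t x y a b} → Close s t → Meets s t x y → Meets s t a b → Conflict x y a b
  meets-close⇒conflict {s} {t} {x} {y} {a} {b} st mxy mab = conflict mxy
    where
      joined : ∀ {z w} → In s t z → In s t w → z ≡ w ⊎ adj G z w ≡ true
      joined (inj₁ refl) (inj₁ refl) = inj₁ refl
      joined (inj₂ refl) (inj₂ refl) = inj₁ refl
      joined (inj₁ refl) (inj₂ refl) = st
      joined (inj₂ refl) (inj₁ refl) = [ (λ e → inj₁ (sym e)) , (λ e → inj₂ (adj-flip e)) ]′ st
      near : ∀ {z} → In s t z → Meets s t a b → Near z a b
      near iz (inj₁ ia) = [ is-left , adj-left ]′ (joined iz ia)
      near iz (inj₂ ib) = [ is-right , adj-right ]′ (joined iz ib)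
      conflict : Meets s t x y → Conflict x y a b
      conflict (inj₁ ix) = inj₁ (near ix mab)
      conflict (inj₂ iy) = inj₂ (near iy mab)

  maximal-nonempty : ∀ {M u v} → IsMaximalInducedMatching G M → adj G u v ≡ true →
    Σ (Fin n) λ a → Σ (Fin n) λ b → M a b ≡ true
  maximal-nonempty {M} {u} {v} maxM uv∈G with dominating-if-maximal maxM u v uv∈G
  ... | inj₁ muv = u , v , muv
  ... | inj₂ (a , b , mab , _) = a , b , mab

  maximal-size≡1 : ∀ {s t u v} → Close s t → (∀ x y → adj G x y ≡ true → Meets s t x y) → adj G u v ≡ true →
    ∀ M → IsMaximalInducedMatching G M → size G M ≡ 1
  maximal-size≡1 st meets uv∈G M maxM@(im , _) with maximal-nonempty maxM uv∈G
  ... | a , b , mab = size≡1 im mab only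
    where
      only : ∀ x y → M x y ≡ true → SameEdge x y a b
      only x y mxy = IM-conflict⇒sameEdge im mxy mab
          (meets-close⇒conflict st (meets x y (IM-adj im mxy)) (meets a b (IM-adj im mab)))

  private
    matched-meeting : ∀ {M u v s t} → IsMaximalInducedMatching G M → adj G u v ≡ true →
      (∀ x y → adj G x y ≡ true → Conflict u v x y → Meets s t x y) →
      Σ (Fin n) λ a → Σ (Fin n) λ b → M a b ≡ true × Meets s t a b
    matched-meeting {M} {u} {v} maxM uv∈G meets with dominating-if-maximal maxM u v uv∈G
    ... | inj₁ muv = u , v , muv , meets u v uv∈G (inj₁ (inj₁ refl))
    ... | inj₂ (a , b , mab , c) = a , b , mab , meets a b (IM-adj (proj₁ maxM) mab) c

  maximal-size≡2 : ∀ {s₁ t₁ s₂ t₂ u₁ v₁ u₂ v₂} → Close s₁ t₁ → Close s₂ t₂ →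
    (∀ x y → adj G x y ≡ true → Meets s₁ t₁ x y ⊎ Meets s₂ t₂ x y) →
    (∀ x y → adj G x y ≡ true → Meets s₁ t₁ x y → ¬ Meets s₂ t₂ x y) →
    adj G u₁ v₁ ≡ true → (∀ x y → adj G x y ≡ true → Conflict u₁ v₁ x y → Meets s₁ t₁ x y) →
    adj G u₂ v₂ ≡ true → (∀ x y → adj G x y ≡ true → Conflict u₂ v₂ x y → Meets s₂ t₂ x y) →
    ∀ M → IsMaximalInducedMatching G M → size G M ≡ 2
  maximal-size≡2 st₁ st₂ cover disjoint uv₁∈G meets₁ uv₂∈G meets₂ M maxM@(im , _)
    with matched-meeting maxM uv₁∈G meets₁ | matched-meeting maxM uv₂∈G meets₂
  ... | a , b , mab , ab-meets₁ | c , d , mcd , cd-meets₂ =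
    size≡2 im mab mcd (λ s → disjoint c d (IM-adj im mcd) (meets-sameEdge s ab-meets₁) cd-meets₂) only
    where
      only : ∀ x y → M x y ≡ true → SameEdge x y a b ⊎ SameEdge x y c d
      only x y mxy with cover x y (IM-adj im mxy)
      ... | inj₁ m₁ = inj₁ (IM-conflict⇒sameEdge im mxy mab (meets-close⇒conflict st₁ m₁ ab-meets₁))
      ... | inj₂ m₂ = inj₂ (IM-conflict⇒sameEdge im mxy mcd (meets-close⇒conflict st₂ m₂ cd-meets₂))

  conflict-meets : ∀ {u v s t} →
    (∀ x y → adj G x y ≡ true → Close u x → Meets s t x y) → (∀ x y → adj G x y ≡ true → Close v x → Meets s t x y) →
    ∀ x y → adj G x y ≡ true → Conflict u v x y → Meets s t x y
  conflict-meets {u} {v} {s} {t} fu fv x y xy∈G = conflict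
    where
      near : ∀ {z} → (∀ x y → adj G x y ≡ true → Close z x → Meets s t x y) → Near z x y → Meets s t x y
      near f (is-left q) = f x y xy∈G (inj₁ q)
      near f (is-right q) = meets-swap (f y x (adj-flip xy∈G) (inj₁ q))
      near f (adj-left q) = f x y xy∈G (inj₂ q)
      near f (adj-right q) = meets-swap (f y x (adj-flip xy∈G) (inj₂ q))
      conflict : Conflict u v x y → Meets s t x y
      conflict (inj₁ q) = near fu q
      conflict (inj₂ q) = near fv q

  conflictsWith-if-near : ∀ {N x y} → (∀ w w′ → adj G w w′ ≡ true → Near w x y → ConflictsWith N w w′) →
    ∀ u v → adj G u v ≡ true → Conflict u v x y → ConflictsWith N u v
  conflictsWith-if-near f u v uv∈G (inj₁ q) = f u v uv∈G q
  conflictsWith-if-near f u v uv∈G (inj₂ q) with f v u (adj-flip uv∈G) q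
  ... | a , b , m , c = a , b , m , [ inj₂ , inj₁ ]′ c

  maximal-exchange : ∀ {N N′} → IsMaximalInducedMatching G N → IsInducedMatching G N′ →
    (∀ x y → N x y ≡ true → N′ x y ≡ true ⊎ (∀ u v → adj G u v ≡ true → Conflict u v x y → ConflictsWith N′ u v)) →
    IsMaximalInducedMatching G N′
  maximal-exchange {N} {N′} maxN im′ replaced = maximal-if-dominating im′ dominating
    where
      dominating : Dominating N′
      dominating u v uv∈G with dominating-if-maximal maxN u v uv∈G
      ... | inj₁ m with replaced u v m
      ...   | inj₁ m′ = inj₁ m′
      ...   | inj₂ f = inj₂ (f u v uv∈G (inj₁ (inj₁ refl)))
      dominating u v uv∈G | inj₂ (x , y , m , c) with replaced x y m
      ...   | inj₁ m′ = inj₂ (x , y , m′ , c)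
      ...   | inj₂ f = inj₂ (f u v uv∈G c)

  2≤deg : ∀ {v x y} → x ≢ y → adj G v x ≡ true → adj G v y ≡ true → 2 ≤ deg G v
  2≤deg {v} {x} {y} x≢y vx vy = length≤count _≟ᶠ_ (adj G v) (allFin n) (allFin⁺ n) (x ∷ y ∷ [])
    ((x≢y ∷ []) ∷ [] ∷ []) (∈-allFin x ∷ ∈-allFin y ∷ []) (vx ∷ vy ∷ [])

  3≤deg : ∀ {v x y z} → x ≢ y → x ≢ z → y ≢ z → adj G v x ≡ true → adj G v y ≡ true → adj G v z ≡ true → 3 ≤ deg G v
  3≤deg {v} {x} {y} {z} x≢y x≢z y≢z vx vy vz = length≤count _≟ᶠ_ (adj G v) (allFin n) (allFin⁺ n) (x ∷ y ∷ z ∷ [])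
    ((x≢y ∷ x≢z ∷ []) ∷ (y≢z ∷ []) ∷ [] ∷ []) (∈-allFin x ∷ ∈-allFin y ∷ ∈-allFin z ∷ []) (vx ∷ vy ∷ vz ∷ [])

  4≤deg : ∀ {v x y z w} → x ≢ y → x ≢ z → x ≢ w → y ≢ z → y ≢ w → z ≢ w →
    adj G v x ≡ true → adj G v y ≡ true → adj G v z ≡ true → adj G v w ≡ true → 4 ≤ deg G v
  4≤deg {v} {x} {y} {z} {w} x≢y x≢z x≢w y≢z y≢w z≢w vx vy vz vw =
    length≤count _≟ᶠ_ (adj G v) (allFin n) (allFin⁺ n) (x ∷ y ∷ z ∷ w ∷ [])
      ((x≢y ∷ x≢z ∷ x≢w ∷ []) ∷ (y≢z ∷ y≢w ∷ []) ∷ (z≢w ∷ []) ∷ [] ∷ [])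
      (∈-allFin x ∷ ∈-allFin y ∷ ∈-allFin z ∷ ∈-allFin w ∷ []) (vx ∷ vy ∷ vz ∷ vw ∷ [])

  wellIndumatched-if-constant : ∀ s → (∀ M → IsMaximalInducedMatching G M → size G M ≡ s) → WellIndumatched G
  wellIndumatched-if-constant s constant M M′ maxM maxM′ = trans (constant M maxM) (sym (constant M′ maxM′))

  ¬wellIndumatched : ∀ {M M′} → IsMaximalInducedMatching G M → IsMaximalInducedMatching G M′ →
    size G M ≡ suc (size G M′) → ¬ WellIndumatched G
  ¬wellIndumatched {M} {M′} maxM maxM′ larger wi = 1+n≢n (trans (sym larger) (wi M M′ maxM maxM′))

  edgeless-size≡0 : (∀ x y → adj G x y ≡ false) → ∀ M → IsMaximalInducedMatching G M → size G M ≡ 0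
  edgeless-size≡0 edgeless M (im , _) = size-empty M unmatched
    where
      unmatched : ∀ u v → M u v ≡ false
      unmatched u v with M u v in e
      ... | false = refl
      ... | true = ⊥-elim (false≢true (edgeless u v) (IM-adj im e))

  edgesOf : List (Fin n × Fin n) → EdgeSet G
  edgesOf [] = ∅ₑ
  edgesOf ((a , b) ∷ es) = insert (edgesOf es) a b

  edgesOf-complete : ∀ {es a b} → (a , b) ∈ es → edgesOf es a b ≡ true
  edgesOf-complete {(a , b) ∷ es} (here refl) = insert-new (edgesOf es) a b
  edgesOf-complete {(c , d) ∷ es} (there ab∈es) = insert-⊇ (edgesOf es) c d _ _ (edgesOf-complete ab∈es)

  edgesOf-sound : ∀ {es x y} → edgesOf es x y ≡ true → Any (λ (a , b) → SameEdge x y a b) es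
  edgesOf-sound {(a , b) ∷ es} {x} {y} e with insert-cases (edgesOf es) a b x y e
  ... | inj₁ m = there (edgesOf-sound m)
  ... | inj₂ s = here s

  IM-edgesOf : ∀ {es} → All (λ (a , b) → adj G a b ≡ true) es → AllPairs (λ (a , b) (c , d) → Separated a b c d) es →
    IsInducedMatching G (edgesOf es)
  IM-edgesOf [] [] = IM-∅
  IM-edgesOf {(a , b) ∷ es} (ab∈G ∷ adjs) (seps ∷ pairs) = IM-insert (IM-edgesOf adjs pairs) ab∈G
      (λ x y m → separated-from seps (edgesOf-sound m))
    where
      separated-from : ∀ {es x y} → All (λ (c , d) → Separated a b c d) es → Any (λ (c , d) → SameEdge x y c d) es →
          Separated a b x y
      separated-from (s ∷ _) (here same) = separated-sym (separated-sameEdge same (separated-sym s))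
      separated-from (_ ∷ ss) (there i) = separated-from ss i

<-lit : ∀ i m → {True (i <ᵇ m)} → i < m
<-lit i m {i<ᵇm} = <ᵇ⇒< i m i<ᵇm

_◂_ : {A : Set} → A → (ℕ → A) → ℕ → A
(x ◂ f) zero = x
(x ◂ f) (suc j) = f j

module _ {n : ℕ} (G : Graph n) where

  -- Paths indexed by ℕ: shifting, reversing and prepending then need no Fin arithmetic.
  IsℕPath : ℕ → (ℕ → Fin n) → Set
  IsℕPath m f = (∀ a b → a < m → b < m → f a ≡ f b → a ≡ b) × (∀ a → suc a < m → adj G (f a) (f (suc a)) ≡ true)

  ℕPath⇒IsPath : ∀ {m f} → IsℕPath m f → IsPath G m (λ i → f (toℕ i))
  ℕPath⇒IsPath {m} {f} (inj , step) =
    (λ {i} {j} e → toℕ-injective (inj (toℕ i) (toℕ j) (toℕ<n i) (toℕ<n j) e)) ,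
    λ i j j≡1+i → subst (λ z → adj G (f (toℕ i)) (f z) ≡ true) (sym j≡1+i) (step (toℕ i) (subst (_< m) j≡1+i (toℕ<n j)))

  ℕPath-drop : ∀ {m f} c m′ → IsℕPath m f → c + m′ ≤ m → IsℕPath m′ (λ j → f (c + j))
  ℕPath-drop {m} {f} c m′ (inj , step) c+m′≤m =
    (λ a b a<m′ b<m′ e → +-cancelˡ-≡ c a b (inj (c + a) (c + b) (shift a<m′) (shift b<m′) e)) ,
    λ a 1+a<m′ → subst (λ z → adj G (f (c + a)) (f z) ≡ true) (sym (+-suc c a))
                   (step (c + a) (subst (_< m) (+-suc c a) (shift 1+a<m′)))
    where
      shift : ∀ {a} → a < m′ → c + a < m
      shift a<m′ = ≤-trans (+-monoʳ-< c a<m′) c+m′≤m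

  ℕPath-reverse : ∀ {m f} c → IsℕPath m f → c < m → IsℕPath (suc c) (λ j → f (c ∸ j))
  ℕPath-reverse {m} {f} c (inj , step) c<m =
    (λ a b a≤c b≤c e → ∸-cancelˡ-≡ (≤-pred a≤c) (≤-pred b≤c) (inj (c ∸ a) (c ∸ b) (bound a) (bound b) e)) ,
    λ a 1+a≤c → backwards a (≤-pred 1+a≤c)
    where
      bound : ∀ a → c ∸ a < m
      bound a = ≤-<-trans (m∸n≤m c a) c<m
      backwards : ∀ a → a < c → adj G (f (c ∸ a)) (f (c ∸ suc a)) ≡ true
      backwards a a<c rewrite +-∸-assoc 1 a<c =
        adj-flip G (step (c ∸ suc a) (subst (_< m) (+-∸-assoc 1 a<c) (bound a)))

  ℕPath-cons : ∀ {m f x} → IsℕPath m f → (∀ a → a < m → f a ≢ x) → (0 < m → adj G x (f 0) ≡ true) →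
    IsℕPath (suc m) (x ◂ f)
  ℕPath-cons {m} {f} {x} (inj , step) x∉f x~f0 = inj′ , step′
    where
      inj′ : ∀ a b → a < suc m → b < suc m → (x ◂ f) a ≡ (x ◂ f) b → a ≡ b
      inj′ zero zero _ _ _ = refl
      inj′ zero (suc b) _ b<m e = ⊥-elim (x∉f b (≤-pred b<m) (sym e))
      inj′ (suc a) zero a<m _ e = ⊥-elim (x∉f a (≤-pred a<m) e)
      inj′ (suc a) (suc b) a<m b<m e = cong suc (inj a b (≤-pred a<m) (≤-pred b<m) e)
      step′ : ∀ a → suc a < suc m → adj G ((x ◂ f) a) ((x ◂ f) (suc a)) ≡ true
      step′ zero h = x~f0 (≤-pred h)
      step′ (suc a) h = step a (≤-pred h)

  -- Out of range it returns the first vertex.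
  lookupℕ : ∀ {m} → (Fin (suc m) → Fin n) → ℕ → Fin n
  lookupℕ {m} g a with a <? suc m
  ... | yes a<1+m = g (fromℕ< a<1+m)
  ... | no _ = g fzero

  lookupℕ-< : ∀ {m} (g : Fin (suc m) → Fin n) a (a<1+m : a < suc m) → lookupℕ g a ≡ g (fromℕ< a<1+m)
  lookupℕ-< {m} g a a<1+m with a <? suc m
  ... | yes a<1+m′ = cong g (toℕ-injective (trans (toℕ-fromℕ< a<1+m′) (sym (toℕ-fromℕ< a<1+m))))
  ... | no a≮1+m = ⊥-elim (a≮1+m a<1+m)

  lookupℕ-toℕ : ∀ {m} (g : Fin (suc m) → Fin n) i → lookupℕ g (toℕ i) ≡ g i
  lookupℕ-toℕ g i = trans (lookupℕ-< g (toℕ i) (toℕ<n i)) (cong g (fromℕ<-toℕ i _))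

  IsPath⇒ℕPath : ∀ {m} (g : Fin (suc m) → Fin n) → IsPath G (suc m) g → IsℕPath (suc m) (lookupℕ g)
  IsPath⇒ℕPath {m} g (inj , step) =
    (λ a b a< b< e → trans (sym (toℕ-fromℕ< a<))
        (trans (cong toℕ (inj (trans (sym (lookupℕ-< g a a<)) (trans e (lookupℕ-< g b b<)))))
                                                        (toℕ-fromℕ< b<))) ,
    λ a 1+a< → subst₂ (λ x y → adj G x y ≡ true) (sym (lookupℕ-< g a (<-trans (n<1+n a) 1+a<)))
        (sym (lookupℕ-< g (suc a) 1+a<))
      (step (fromℕ< (<-trans (n<1+n a) 1+a<)) (fromℕ< 1+a<)
        (trans (toℕ-fromℕ< 1+a<) (cong suc (sym (toℕ-fromℕ< (<-trans (n<1+n a) 1+a<))))))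

Hypotheses : ∀ {n} → Graph n → (k : ℕ) → (Fin k → Fin n) → Set
Hypotheses T k p = IsLongestPath T k p × (∀ i → deg T (p i) ≤ 3) × (∀ i → deg T (p i) ≡ 3 → ∃[ u ] IsPendantEdge T (p i) u)

-- v a is the vertex v_(a+1) of the statement: indices start at 0, and K = k − 1 is the last one.
module LongestPath {n : ℕ} (T : Graph n) (tree : IsTree T) (K : ℕ) (p : Fin (suc K) → Fin n)
  (hyp : Hypotheses T (suc K) p) where

  private
    longest = proj₁ hyp
    deg≤3 = proj₁ (proj₂ hyp)
    pendant = proj₂ (proj₂ hyp)

  k : ℕ
  k = suc K

  v : ℕ → Fin n
  v = lookupℕ T p

  v-path : IsℕPath T k v
  v-path = IsPath⇒ℕPath T p (proj₁ longest)

  ℕPath≤k : ∀ {m f} → IsℕPath T m f → m ≤ k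
  ℕPath≤k {m} {f} path = proj₂ longest m _ (ℕPath⇒IsPath T path)

  no-cycle : ∀ {m f} → IsℕPath T (suc m) f → 2 ≤ m → adj T (f 0) (f m) ≡ true → ⊥
  no-cycle {m} {f} path 2≤m closing = proj₂ (proj₂ tree) (m , (λ j → f (toℕ j)) , 2≤m , ℕPath⇒IsPath T path ,
    subst (λ z → adj T (f 0) (f z) ≡ true) (sym (toℕ-fromℕ m)) closing)

  v-injective : ∀ {a b} → a < k → b < k → v a ≡ v b → a ≡ b
  v-injective {a} {b} = proj₁ v-path a b

  v-≢ : ∀ {a b} → a < k → b < k → a ≢ b → v a ≢ v b
  v-≢ a<k b<k a≢b e = a≢b (v-injective a<k b<k e)

  v-step : ∀ a → suc a < k → adj T (v a) (v (suc a)) ≡ true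
  v-step = proj₂ v-path

  v-step⁻ : ∀ a → suc a < k → adj T (v (suc a)) (v a) ≡ true
  v-step⁻ a h = adj-flip T (v-step a h)

  v-chordless : ∀ a b → b < k → suc (suc a) ≤ b → adj T (v a) (v b) ≡ false
  v-chordless a b b<k 2+a≤b with adj T (v a) (v b) in e
  ... | false = refl
  ... | true = ⊥-elim (no-cycle (ℕPath-drop T a (suc (b ∸ a)) v-path fits)
        (subst (_≤ b ∸ a) (m+n∸n≡m 2 a) (∸-monoˡ-≤ a 2+a≤b)) closing)
    where
      a≤b : a ≤ b
      a≤b = ≤-trans (n≤1+n a) (≤-trans (n≤1+n (suc a)) 2+a≤b)
      fits : a + suc (b ∸ a) ≤ k
      fits = subst (_≤ k) (trans (cong suc (sym (m+[n∸m]≡n a≤b))) (sym (+-suc a (b ∸ a)))) b<k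
      closing : adj T (v (a + 0)) (v (a + (b ∸ a))) ≡ true
      closing rewrite +-identityʳ a | m+[n∸m]≡n a≤b = e

  v-adjacent : ∀ {a b} → a < k → b < k → adj T (v a) (v b) ≡ true → suc a ≡ b ⊎ suc b ≡ a
  v-adjacent {a} {b} a<k b<k e with <-cmp a b
  ... | tri≈ _ refl _ = ⊥-elim (adj⇒≢ T e refl)
  ... | tri< a<b _ _ with m≤n⇒m<n∨m≡n a<b
  ...   | inj₂ 1+a≡b = inj₁ 1+a≡b
  ...   | inj₁ 1+a<b = ⊥-elim (false≢true (v-chordless a b b<k 1+a<b) e)
  v-adjacent {a} {b} a<k b<k e | tri> _ _ b<a with m≤n⇒m<n∨m≡n b<a
  ...   | inj₂ 1+b≡a = inj₂ 1+b≡a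
  ...   | inj₁ 1+b<a = ⊥-elim (false≢true (v-chordless b a a<k 1+b<a) (adj-flip T e))

  deg-v≤3 : ∀ {a} → a < k → deg T (v a) ≤ 3
  deg-v≤3 {a} a<k rewrite lookupℕ-< T p a a<k = deg≤3 (fromℕ< a<k)

  v-pendant : ∀ {a} → a < k → deg T (v a) ≡ 3 → Σ (Fin n) λ u → adj T (v a) u ≡ true × (deg T (v a) ≡ 1 ⊎ deg T u ≡ 1)
  v-pendant {a} a<k rewrite lookupℕ-< T p a a<k = pendant (fromℕ< a<k)

  OnPath : Fin n → Set
  OnPath x = Σ ℕ λ a → a < k × v a ≡ x

  OffPath : Fin n → Set
  OffPath x = ∀ a → a < k → v a ≢ x

  onPath? : ∀ x → Dec (OnPath x)
  onPath? x with any? (λ i → p i ≟ᶠ x)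
  ... | yes (i , e) = yes (toℕ i , toℕ<n i , trans (lookupℕ-toℕ T p i) e)
  ... | no ¬on = no λ (a , a<k , e) → ¬on (fromℕ< a<k , trans (sym (lookupℕ-< T p a a<k)) e)

  ¬onPath⇒offPath : ∀ {x} → ¬ OnPath x → OffPath x
  ¬onPath⇒offPath ¬on a a<k e = ¬on (a , a<k , e)

  -- Otherwise P could be lengthened at that end.
  offPath-¬adj-first : ∀ {x} → OffPath x → adj T x (v 0) ≡ true → ⊥
  offPath-¬adj-first off x~v₀ = 1+n≰n (ℕPath≤k (ℕPath-cons T v-path off (λ _ → x~v₀)))

  offPath-¬adj-last : ∀ {x} → OffPath x → adj T x (v K) ≡ true → ⊥
  offPath-¬adj-last off x~vK = 1+n≰n (ℕPath≤k (ℕPath-cons T (ℕPath-reverse T K v-path (n<1+n K))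
    (λ a _ → off (K ∸ a) (s≤s (m∸n≤m K a))) (λ _ → x~vK)))

  2≤deg-inner : ∀ c → suc (suc c) < k → 2 ≤ deg T (v (suc c))
  2≤deg-inner c 2+c<k = 2≤deg T (v-≢ c<k 2+c<k (λ ())) (v-step⁻ c 1+c<k) (v-step (suc c) 2+c<k)
    where
      1+c<k : suc c < k
      1+c<k = <-trans (n<1+n (suc c)) 2+c<k
      c<k : c < k
      c<k = <-trans (n<1+n c) 1+c<k

  private
    prepend₂ : ∀ {m f x₁ x₂} → IsℕPath T m f → (∀ j → j < m → f j ≢ x₁) → (∀ j → j < m → f j ≢ x₂) →
      adj T x₁ (f 0) ≡ true → adj T x₂ x₁ ≡ true → suc (suc m) ≤ k
    prepend₂ {m} {f} {x₁} {x₂} path x₁∉f x₂∉f x₁~f₀ x₂~x₁ =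
      ℕPath≤k (ℕPath-cons T (ℕPath-cons T path x₁∉f (λ _ → x₁~f₀)) x₂∉x₁f (λ _ → x₂~x₁))
      where
        x₂∉x₁f : ∀ j → j < suc m → (x₁ ◂ f) j ≢ x₂
        x₂∉x₁f zero _ e = adj⇒≢ T x₂~x₁ (sym e)
        x₂∉x₁f (suc j) h = x₂∉f j (≤-pred h)

    2≤deg⇒≢1 : ∀ {w} → 2 ≤ deg T w → deg T w ≢ 1
    2≤deg⇒≢1 2≤d d≡1 = 1+n≰n (subst (2 ≤_) d≡1 2≤d)

    crowded : ∀ {x₁ x₂} c → OffPath x₁ → OffPath x₂ → suc (suc (suc (suc c))) < k →
      adj T x₁ (v (suc (suc c))) ≡ true → adj T x₂ x₁ ≡ true → ⊥
    crowded {x₁} {x₂} c off₁ off₂ 4+c<k x₁~v x₂~x₁ = no-room (v-pendant a<k deg≡3)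
      where
        3+c<k : suc (suc (suc c)) < k
        3+c<k = <-trans (n<1+n _) 4+c<k
        a<k : suc (suc c) < k
        a<k = <-trans (n<1+n _) 3+c<k
        prev≢next : v (suc c) ≢ v (suc (suc (suc c)))
        prev≢next = v-≢ (<-trans (n<1+n _) a<k) 3+c<k (<⇒≢ (<-trans (n<1+n _) (n<1+n _)))
        v~x₁ : adj T (v (suc (suc c))) x₁ ≡ true
        v~x₁ = adj-flip T x₁~v
        3≤d : 3 ≤ deg T (v (suc (suc c)))
        3≤d = 3≤deg T prev≢next (off₁ (suc c) (<-trans (n<1+n _) a<k)) (off₁ (suc (suc (suc c))) 3+c<k)
                (v-step⁻ (suc c) a<k) (v-step (suc (suc c)) 3+c<k) v~x₁
        deg≡3 : deg T (v (suc (suc c))) ≡ 3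
        deg≡3 = ≤-antisym (deg-v≤3 a<k) 3≤d
        no-room : (Σ (Fin n) λ u → adj T (v (suc (suc c))) u ≡ true × (deg T (v (suc (suc c))) ≡ 1 ⊎ deg T u ≡ 1)) → ⊥
        no-room (u , _ , inj₁ d≡1) = 1+n≰n (≤-trans (subst (3 ≤_) d≡1 3≤d) (s≤s z≤n))
        no-room (u , v~u , inj₂ du≡1) with u ≟ᶠ v (suc c) | u ≟ᶠ v (suc (suc (suc c))) | u ≟ᶠ x₁
        ... | yes refl | _ | _ = 2≤deg⇒≢1 (2≤deg-inner c a<k) du≡1
        ... | no _ | yes refl | _ = 2≤deg⇒≢1 (2≤deg-inner (suc (suc c)) 4+c<k) du≡1
        ... | no _ | no _ | yes refl = 2≤deg⇒≢1 (2≤deg T (λ e → off₂ (suc (suc c)) a<k (sym e)) (adj-flip T x₂~x₁) x₁~v) du≡1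
        ... | no u≢prev | no u≢next | no u≢x₁ = 1+n≰n (≤-trans
              (4≤deg T prev≢next (off₁ (suc c) (<-trans (n<1+n _) a<k)) (λ e → u≢prev (sym e))
                  (off₁ (suc (suc (suc c))) 3+c<k)
                     (λ e → u≢next (sym e)) (λ e → u≢x₁ (sym e)) (v-step⁻ (suc c) a<k) (v-step (suc (suc c)) 3+c<k) v~x₁ v~u)
              (deg-v≤3 a<k))

  -- The path x₂ x₁ v a, continued to either end of P, is no longer than P; hence 2 ≤ a ≤ k − 3.
  -- Then v a has the three neighbours v (a − 1), v (a + 1) and x₁, each of degree at least 2,
  -- which leaves no room for its pendant edge.
  no-offPath-at-distance-2 : ∀ {x₁ x₂ a} → OffPath x₁ → OffPath x₂ → a < k →
    adj T x₁ (v a) ≡ true → adj T x₂ x₁ ≡ true → ⊥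
  no-offPath-at-distance-2 {x₁} {x₂} {a} off₁ off₂ a<k x₁~v x₂~x₁ = by-position a x₁~v toEnd toStart
    where
      a≤k : a ≤ k
      a≤k = ≤-trans (n≤1+n a) a<k
      toEnd : suc (suc (k ∸ a)) ≤ k
      toEnd = prepend₂ (ℕPath-drop T a (k ∸ a) v-path (subst (_≤ k) (sym (m+[n∸m]≡n a≤k)) ≤-refl))
        (λ j h → off₁ (a + j) (onward h)) (λ j h → off₂ (a + j) (onward h))
            (subst (λ z → adj T x₁ (v z) ≡ true) (sym (+-identityʳ a)) x₁~v) x₂~x₁
        where
          onward : ∀ {j} → j < k ∸ a → a + j < k
          onward {j} h = subst (a + j <_) (m+[n∸m]≡n a≤k) (+-monoʳ-< a h)
      toStart : suc (suc (suc a)) ≤ k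
      toStart = prepend₂ (ℕPath-reverse T a v-path a<k)
        (λ j _ → off₁ (a ∸ j) (≤-<-trans (m∸n≤m a j) a<k)) (λ j _ → off₂ (a ∸ j) (≤-<-trans (m∸n≤m a j) a<k)) x₁~v x₂~x₁
      by-position : ∀ b → adj T x₁ (v b) ≡ true → suc (suc (k ∸ b)) ≤ k → suc (suc (suc b)) ≤ k → ⊥
      by-position zero _ 2+k≤k _ = 1+n≰n (≤-trans (n≤1+n _) 2+k≤k)
      by-position (suc zero) _ 1+k≤k _ = 1+n≰n 1+k≤k
      by-position (suc (suc c)) x₁~v _ 5+c≤k = crowded c off₁ off₂ 5+c≤k x₁~v x₂~x₁

  private
    NearPath : Fin n → Set
    NearPath x = OnPath x ⊎ (Σ ℕ λ a → a < k × adj T x (v a) ≡ true)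

    nearPath-step : ∀ {x y} → adj T x y ≡ true → NearPath y → NearPath x
    nearPath-step {x} {y} x~y near with onPath? x
    ... | yes on = inj₁ on
    ... | no ¬on with near
    ...   | inj₁ (b , b<k , refl) = inj₂ (b , b<k , x~y)
    ...   | inj₂ (a , a<k , y~v) with onPath? y
    ...     | yes (b , b<k , refl) = inj₂ (b , b<k , x~y)
    ...     | no ¬on′ = ⊥-elim (no-offPath-at-distance-2 (¬onPath⇒offPath ¬on′) (¬onPath⇒offPath ¬on) a<k y~v x~y)

  -- Walk back from v 0 to w along the path joining them: every vertex met is near P.
  offPath-attached : ∀ {w} → OffPath w → Σ ℕ λ a → a < k × adj T w (v a) ≡ true
  offPath-attached {w} off = from-near (along (proj₁ (proj₂ tree) w (v 0)))
    where
      from-near : NearPath w → Σ ℕ λ a → a < k × adj T w (v a) ≡ true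
      from-near (inj₁ (a , a<k , e)) = ⊥-elim (off a a<k e)
      from-near (inj₂ attached) = attached
      along : (∃[ m ] Σ (Fin (suc m) → Fin n) λ q → IsPath T (suc m) q × q fzero ≡ w × q (fromℕ m) ≡ v 0) → NearPath w
      along (m , q , q-path , q₀≡w , qm≡v₀) = subst NearPath (trans (cong Q (n∸n≡0 m)) q₀≡w) (walk m ≤-refl)
        where
          Q : ℕ → Fin n
          Q = lookupℕ T q
          walk : ∀ d → d ≤ m → NearPath (Q (m ∸ d))
          walk zero _ = inj₁ (0 , s≤s z≤n , sym
              (trans (cong Q (sym (toℕ-fromℕ m))) (trans (lookupℕ-toℕ T q (fromℕ m)) qm≡v₀)))
          walk (suc d) d<m = nearPath-step step (walk d (≤-trans (n≤1+n d) d<m))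
            where
              step : adj T (Q (m ∸ suc d)) (Q (m ∸ d)) ≡ true
              step = subst (λ z → adj T (Q (m ∸ suc d)) (Q z) ≡ true) (sym (+-∸-assoc 1 d<m))
                       (proj₂ (IsPath⇒ℕPath T q q-path) (m ∸ suc d) (s≤s (subst (_≤ m) (+-∸-assoc 1 d<m) (m∸n≤m m d))))

  offPath-neighbour-onPath : ∀ {w y} → OffPath w → adj T w y ≡ true → OnPath y
  offPath-neighbour-onPath {w} {y} off w~y with onPath? y
  ... | yes on = on
  ... | no ¬on with offPath-attached off
  ...   | a , a<k , w~v = ⊥-elim (no-offPath-at-distance-2 off (¬onPath⇒offPath ¬on) a<k w~v (adj-flip T w~y))

  private
    no-two-attachments : ∀ {w a b} → OffPath w → a < b → b < k → adj T w (v a) ≡ true → adj T w (v b) ≡ true → ⊥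
    no-two-attachments {w} {a} {b} off a<b b<k w~va w~vb =
      no-cycle (ℕPath-cons T segment (λ j h → off (a + j) (inside h)) (λ _ → w~va′))
          (s≤s (subst (1 ≤_) (sym (+-∸-assoc 1 a<b)) (s≤s z≤n))) w~vb′
      where
        a≤b : a ≤ b
        a≤b = ≤-trans (n≤1+n a) a<b
        segment : IsℕPath T (suc (b ∸ a)) (λ j → v (a + j))
        segment = ℕPath-drop T a (suc (b ∸ a)) v-path
            (subst (_≤ k) (trans (cong suc (sym (m+[n∸m]≡n a≤b))) (sym (+-suc a _))) b<k)
        inside : ∀ {j} → j < suc (b ∸ a) → a + j < k
        inside h = ≤-<-trans (subst (_ ≤_) (m+[n∸m]≡n a≤b) (+-monoʳ-≤ a (≤-pred h))) b<k
        w~va′ : adj T w (v (a + 0)) ≡ true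
        w~va′ rewrite +-identityʳ a = w~va
        w~vb′ : adj T w (v (a + (b ∸ a))) ≡ true
        w~vb′ rewrite m+[n∸m]≡n a≤b = w~vb

  attachment-unique : ∀ {w a b} → OffPath w → a < k → b < k → adj T w (v a) ≡ true → adj T w (v b) ≡ true → a ≡ b
  attachment-unique {w} {a} {b} off a<k b<k w~va w~vb with <-cmp a b
  ... | tri< a<b _ _ = ⊥-elim (no-two-attachments off a<b b<k w~va w~vb)
  ... | tri≈ _ a≡b _ = a≡b
  ... | tri> _ _ b<a = ⊥-elim (no-two-attachments off b<a a<k w~vb w~va)

  LeafAt : Fin n → ℕ → Set
  LeafAt w a = OffPath w × a < k × adj T w (v a) ≡ true

  leafAt-neighbour : ∀ {w a y} → LeafAt w a → adj T w y ≡ true → y ≡ v a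
  leafAt-neighbour {w} {a} (off , a<k , w~va) w~y with offPath-neighbour-onPath off w~y
  ... | b , b<k , refl = cong v (attachment-unique off b<k a<k w~y w~va)

  ¬leafAt-first : ∀ {w} → ¬ LeafAt w 0
  ¬leafAt-first (off , _ , w~v₀) = offPath-¬adj-first off w~v₀

  ¬leafAt-last : ∀ {w} → ¬ LeafAt w K
  ¬leafAt-last (off , _ , w~vK) = offPath-¬adj-last off w~vK

  neighbour-of-v : ∀ {a z} → a < k → adj T z (v a) ≡ true →
    (Σ ℕ λ b → b < k × z ≡ v b × (suc b ≡ a ⊎ suc a ≡ b)) ⊎ LeafAt z a
  neighbour-of-v {a} {z} a<k z~va with onPath? z
  ... | yes (b , b<k , refl) = inj₁ (b , b<k , refl , v-adjacent b<k a<k z~va)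
  ... | no ¬on = inj₂ (¬onPath⇒offPath ¬on , a<k , z~va)

  first-neighbour : ∀ {y} → adj T y (v 0) ≡ true → y ≡ v 1
  first-neighbour y~v₀ with neighbour-of-v (s≤s z≤n) y~v₀
  ... | inj₁ (b , _ , y≡vb , inj₂ refl) = y≡vb
  ... | inj₂ leaf = ⊥-elim (¬leafAt-first leaf)

  last-neighbour : ∀ {y} → adj T y (v K) ≡ true → Σ ℕ λ b → suc b ≡ K × y ≡ v b
  last-neighbour y~vK with neighbour-of-v (n<1+n K) y~vK
  ... | inj₁ (b , _ , y≡vb , inj₁ 1+b≡K) = b , 1+b≡K , y≡vb
  ... | inj₁ (b , b<k , _ , inj₂ refl) = ⊥-elim (1+n≰n b<k)
  ... | inj₂ leaf = ⊥-elim (¬leafAt-last leaf)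

  edge-cases : ∀ {Q : Fin n → Fin n → Set} → (∀ b → b < k → ∀ y → adj T (v b) y ≡ true → Q (v b) y) →
    (∀ x a → LeafAt x a → Q x (v a)) → ∀ x y → adj T x y ≡ true → Q x y
  edge-cases onP leaf x y x~y with onPath? x
  ... | yes (b , b<k , refl) = onP b b<k y x~y
  ... | no ¬on with offPath-attached (¬onPath⇒offPath ¬on)
  ...   | a , a<k , x~va with leafAt-neighbour (¬onPath⇒offPath ¬on , a<k , x~va) x~y
  ...     | refl = leaf x a (¬onPath⇒offPath ¬on , a<k , x~va)

  v-far : ∀ {a c} → suc a < c → c < k → Far T (v a) (v c)
  v-far {a} {c} 1+a<c c<k = v-≢ (<-trans (n<1+n a) (<-trans 1+a<c c<k)) c<k (<⇒≢ (<-trans (n<1+n a) 1+a<c)) ,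
      v-chordless a c c<k 1+a<c

  v-edges-separated : ∀ {a c} → suc (suc a) < c → suc c < k → Separated T (v a) (v (suc a)) (v c) (v (suc c))
  v-edges-separated {a} {c} 2+a<c 1+c<k =
    separated T (v-far (<-trans (n<1+n _) 2+a<c) c<k) (v-far (<-trans (<-trans (n<1+n _) 2+a<c) (n<1+n c)) 1+c<k)
                (v-far 2+a<c c<k) (v-far (<-trans 2+a<c (n<1+n c)) 1+c<k)
    where
      c<k : c < k
      c<k = <-trans (n<1+n c) 1+c<k

  leafAt-far : ∀ {ℓ a b} → LeafAt ℓ a → b < k → b ≢ a → Far T ℓ (v b)
  leafAt-far {ℓ} {a} {b} leaf@(off , _ , _) b<k b≢a = (λ e → off b b<k (sym e)) , ℓ≁vb
    where
      ℓ≁vb : adj T ℓ (v b) ≡ false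
      ℓ≁vb with adj T ℓ (v b) in e
      ... | false = refl
      ... | true = ⊥-elim (b≢a (v-injective b<k (proj₁ (proj₂ leaf)) (leafAt-neighbour leaf e)))

  -- Its path neighbours have degree at least 2, so the pendant edge at v a leads to a leaf.
  pendant-leaf : ∀ c → suc (suc (suc (suc c))) < k → deg T (v (suc (suc c))) ≡ 3 → Σ (Fin n) λ ℓ → LeafAt ℓ (suc (suc c))
  pendant-leaf c 4+c<k deg≡3 = from-pendant (v-pendant a<k deg≡3)
    where
      3+c<k : suc (suc (suc c)) < k
      3+c<k = <-trans (n<1+n _) 4+c<k
      a<k : suc (suc c) < k
      a<k = <-trans (n<1+n _) 3+c<k
      from-pendant : (Σ (Fin n) λ u → adj T (v (suc (suc c))) u ≡ true × (deg T (v (suc (suc c))) ≡ 1 ⊎ deg T u ≡ 1)) →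
        Σ (Fin n) λ ℓ → LeafAt ℓ (suc (suc c))
      from-pendant (_ , _ , inj₁ d≡1) = ⊥-elim (2≤deg⇒≢1 (2≤deg-inner (suc c) 3+c<k) d≡1)
      from-pendant (u , v~u , inj₂ du≡1) with neighbour-of-v a<k (adj-flip T v~u)
      ... | inj₁ (_ , _ , refl , inj₁ refl) = ⊥-elim (2≤deg⇒≢1 (2≤deg-inner c a<k) du≡1)
      ... | inj₁ (_ , _ , refl , inj₂ refl) = ⊥-elim (2≤deg⇒≢1 (2≤deg-inner (suc (suc c)) 4+c<k) du≡1)
      ... | inj₂ leaf = u , leaf

  v-¬sameEdge : ∀ {a c d y} → a < k → c < k → d < k → a ≢ c → a ≢ d → ¬ SameEdge T (v a) y (v c) (v d)
  v-¬sameEdge a<k c<k d<k a≢c a≢d (inj₁ (e , _)) = v-≢ a<k c<k a≢c e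
  v-¬sameEdge a<k c<k d<k a≢c a≢d (inj₂ (e , _)) = v-≢ a<k d<k a≢d e

  -- A vertex z next to v b that is not on P is a leaf, so its only neighbour is v b.
  far-from-v : ∀ {b y z z′} → b < k → adj T (v b) y ≡ true → adj T z y ≡ false → adj T z′ y ≡ false →
    (∀ c → c < k → (suc c ≡ b ⊎ suc b ≡ c) → z ≢ v c) → adj T z z′ ≡ true → Far T (v b) z
  far-from-v {b} {y} {z} {z′} b<k vb~y z≁y z′≁y z∉P[b] z~z′ = vb≢z , vb≁z
    where
      vb≢z : v b ≢ z
      vb≢z refl = false≢true z≁y vb~y
      vb≁z : adj T (v b) z ≡ false
      vb≁z with adj T (v b) z in e
      ... | false = refl
      ... | true with neighbour-of-v b<k (adj-flip T e)
      ...   | inj₁ (c , c<k , z≡vc , c~b) = ⊥-elim (z∉P[b] c c<k c~b z≡vc)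
      ...   | inj₂ leaf with leafAt-neighbour leaf z~z′
      ...     | refl = ⊥-elim (false≢true z′≁y vb~y)

module _ {n : ℕ} {T : Graph n} (tree : IsTree T) where

  short-wellIndumatched : ∀ K (p : Fin (suc K) → Fin n) → Hypotheses T (suc K) p → K ≤ 3 → WellIndumatched T
  short-wellIndumatched 0 p hyp _ = wellIndumatched-if-constant T 0 (edgeless-size≡0 T edgeless)
    where
      open LongestPath T tree 0 p hyp
      edgeless : ∀ x y → adj T x y ≡ false
      edgeless x y with adj T x y in e
      ... | false = refl
      ... | true = ⊥-elim (edge-cases {Q = λ _ _ → ⊥} at-v₀ at-leaf x y e)
        where
          at-v₀ : ∀ b → b < 1 → ∀ y → adj T (v b) y ≡ true → ⊥
          at-v₀ 0 _ y v₀~y with neighbour-of-v (s≤s z≤n) (adj-flip T v₀~y)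
          ... | inj₁ (c , s≤s () , _ , inj₂ refl)
          ... | inj₂ leaf = ¬leafAt-first leaf
          at-v₀ (suc _) (s≤s ()) _ _
          at-leaf : ∀ x a → LeafAt x a → ⊥
          at-leaf x 0 leaf = ¬leafAt-first leaf
          at-leaf x (suc _) (_ , s≤s () , _)
  short-wellIndumatched 1 p hyp _ =
    wellIndumatched-if-constant T 1 (maximal-size≡1 T (inj₁ refl) (edge-cases meets leaf-meets) (v-step 0 (<-lit 1 2)))
    where
      open LongestPath T tree 1 p hyp
      meets : ∀ b → b < 2 → ∀ y → adj T (v b) y ≡ true → Meets T (v 1) (v 1) (v b) y
      meets 0 _ y v₀~y = inj₂ (inj₁ (first-neighbour (adj-flip T v₀~y)))
      meets 1 _ y _ = inj₁ (inj₁ refl)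
      meets (suc (suc _)) (s≤s (s≤s ())) _ _
      leaf-meets : ∀ x a → LeafAt x a → Meets T (v 1) (v 1) x (v a)
      leaf-meets x 0 leaf = ⊥-elim (¬leafAt-first leaf)
      leaf-meets x 1 leaf = ⊥-elim (¬leafAt-last leaf)
      leaf-meets x (suc (suc _)) (_ , s≤s (s≤s ()) , _)
  short-wellIndumatched 2 p hyp _ =
    wellIndumatched-if-constant T 1
        (maximal-size≡1 T (inj₂ (v-step 1 (<-lit 2 3))) (edge-cases meets leaf-meets) (v-step 0 (<-lit 1 3)))
    where
      open LongestPath T tree 2 p hyp
      meets : ∀ b → b < 3 → ∀ y → adj T (v b) y ≡ true → Meets T (v 1) (v 2) (v b) y
      meets 0 _ y v₀~y = inj₂ (inj₁ (first-neighbour (adj-flip T v₀~y)))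
      meets 1 _ y _ = inj₁ (inj₁ refl)
      meets 2 _ y _ = inj₁ (inj₂ refl)
      meets (suc (suc (suc _))) (s≤s (s≤s (s≤s ()))) _ _
      leaf-meets : ∀ x a → LeafAt x a → Meets T (v 1) (v 2) x (v a)
      leaf-meets x 0 leaf = ⊥-elim (¬leafAt-first leaf)
      leaf-meets x 1 leaf = inj₂ (inj₁ refl)
      leaf-meets x 2 leaf = ⊥-elim (¬leafAt-last leaf)
      leaf-meets x (suc (suc (suc _))) (_ , s≤s (s≤s (s≤s ())) , _)
  short-wellIndumatched 3 p hyp _ =
    wellIndumatched-if-constant T 1
        (maximal-size≡1 T (inj₂ (v-step 1 (<-lit 2 4))) (edge-cases meets leaf-meets) (v-step 0 (<-lit 1 4)))
    where
      open LongestPath T tree 3 p hyp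
      meets : ∀ b → b < 4 → ∀ y → adj T (v b) y ≡ true → Meets T (v 1) (v 2) (v b) y
      meets 0 _ y v₀~y = inj₂ (inj₁ (first-neighbour (adj-flip T v₀~y)))
      meets 1 _ y _ = inj₁ (inj₁ refl)
      meets 2 _ y _ = inj₁ (inj₂ refl)
      meets 3 _ y v₃~y with last-neighbour (adj-flip T v₃~y)
      ... | 2 , refl , y≡v₂ = inj₂ (inj₂ y≡v₂)
      meets (suc (suc (suc (suc _)))) (s≤s (s≤s (s≤s (s≤s ())))) _ _
      leaf-meets : ∀ x a → LeafAt x a → Meets T (v 1) (v 2) x (v a)
      leaf-meets x 0 leaf = ⊥-elim (¬leafAt-first leaf)
      leaf-meets x 1 leaf = inj₂ (inj₁ refl)
      leaf-meets x 2 leaf = inj₂ (inj₂ refl)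
      leaf-meets x 3 leaf = ⊥-elim (¬leafAt-last leaf)
      leaf-meets x (suc (suc (suc (suc _)))) (_ , s≤s (s≤s (s≤s (s≤s ()))) , _)
  short-wellIndumatched (suc (suc (suc (suc _)))) _ _ (s≤s (s≤s (s≤s ())))

  -- Every edge conflicting with v₀v₁ (resp. v₅v₆) meets v₁v₂ (resp. v₄v₅), so a maximal induced
  -- matching has an edge meeting each of them.
  seven-wellIndumatched : ∀ p (hyp : Hypotheses T 7 p) → deg T (LongestPath.v T tree 6 p hyp 3) ≡ 2 → WellIndumatched T
  seven-wellIndumatched p hyp deg-v₃≡2 =
    wellIndumatched-if-constant T 2 (maximal-size≡2 T (inj₂ (v-step 1 (<-lit 2 7))) (inj₂ (v-step 4 (<-lit 5 7)))
      (edge-cases meets leaf-meets) disjoint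
      (v-step 0 (<-lit 1 7)) (conflict-meets T near-v₀ near-v₁) (v-step 5 (<-lit 6 7)) (conflict-meets T near-v₅ near-v₆))
    where
      open LongestPath T tree 6 p hyp
      Meets₁ = Meets T (v 1) (v 2)
      Meets₂ = Meets T (v 4) (v 5)

      ¬leafAt-3 : ∀ {w} → ¬ LeafAt w 3
      ¬leafAt-3 (off , _ , w~v₃) = 1+n≰n (subst (3 ≤_) deg-v₃≡2
        (3≤deg T (v-≢ (<-lit 2 7) (<-lit 4 7) (λ ())) (off 2 (<-lit 2 7)) (off 4 (<-lit 4 7))
          (v-step⁻ 2 (<-lit 3 7)) (v-step 3 (<-lit 4 7)) (adj-flip T w~v₃)))

      meets : ∀ b → b < 7 → ∀ y → adj T (v b) y ≡ true → Meets₁ (v b) y ⊎ Meets₂ (v b) y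
      meets 0 _ y v₀~y = inj₁ (inj₂ (inj₁ (first-neighbour (adj-flip T v₀~y))))
      meets 1 _ y _ = inj₁ (inj₁ (inj₁ refl))
      meets 2 _ y _ = inj₁ (inj₁ (inj₂ refl))
      meets 3 _ y v₃~y with neighbour-of-v (<-lit 3 7) (adj-flip T v₃~y)
      ... | inj₁ (_ , _ , y≡v₂ , inj₁ refl) = inj₁ (inj₂ (inj₂ y≡v₂))
      ... | inj₁ (_ , _ , y≡v₄ , inj₂ refl) = inj₂ (inj₂ (inj₁ y≡v₄))
      ... | inj₂ leaf = ⊥-elim (¬leafAt-3 leaf)
      meets 4 _ y _ = inj₂ (inj₁ (inj₁ refl))
      meets 5 _ y _ = inj₂ (inj₁ (inj₂ refl))
      meets 6 _ y v₆~y with last-neighbour (adj-flip T v₆~y)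
      ... | 5 , refl , y≡v₅ = inj₂ (inj₂ (inj₂ y≡v₅))
      meets (suc (suc (suc (suc (suc (suc (suc _))))))) (s≤s (s≤s (s≤s (s≤s (s≤s (s≤s (s≤s ()))))))) _ _

      leaf-meets : ∀ x a → LeafAt x a → Meets₁ x (v a) ⊎ Meets₂ x (v a)
      leaf-meets x 0 leaf = ⊥-elim (¬leafAt-first leaf)
      leaf-meets x 1 leaf = inj₁ (inj₂ (inj₁ refl))
      leaf-meets x 2 leaf = inj₁ (inj₂ (inj₂ refl))
      leaf-meets x 3 leaf = ⊥-elim (¬leafAt-3 leaf)
      leaf-meets x 4 leaf = inj₂ (inj₂ (inj₁ refl))
      leaf-meets x 5 leaf = inj₂ (inj₂ (inj₂ refl))
      leaf-meets x 6 leaf = ⊥-elim (¬leafAt-last leaf)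
      leaf-meets x (suc (suc (suc (suc (suc (suc (suc _))))))) (_ , s≤s (s≤s (s≤s (s≤s (s≤s (s≤s (s≤s ())))))) , _)

      far : ∀ {z w} → In T (v 1) (v 2) z → In T (v 4) (v 5) w → Far T z w
      far (inj₁ refl) (inj₁ refl) = v-far (<-lit 2 4) (<-lit 4 7)
      far (inj₁ refl) (inj₂ refl) = v-far (<-lit 2 5) (<-lit 5 7)
      far (inj₂ refl) (inj₁ refl) = v-far (<-lit 3 4) (<-lit 4 7)
      far (inj₂ refl) (inj₂ refl) = v-far (<-lit 3 5) (<-lit 5 7)

      disjoint : ∀ x y → adj T x y ≡ true → Meets₁ x y → ¬ Meets₂ x y
      disjoint x y _ (inj₁ i) (inj₁ j) = proj₁ (far i j) refl
      disjoint x y x~y (inj₁ i) (inj₂ j) = false≢true (proj₂ (far i j)) x~y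
      disjoint x y x~y (inj₂ i) (inj₁ j) = false≢true (proj₂ (far i j)) (adj-flip T x~y)
      disjoint x y _ (inj₂ i) (inj₂ j) = proj₁ (far i j) refl

      near-v₀ : ∀ x y → adj T x y ≡ true → Close T (v 0) x → Meets₁ x y
      near-v₀ x y x~y (inj₁ refl) = inj₂ (inj₁ (first-neighbour (adj-flip T x~y)))
      near-v₀ x y _ (inj₂ v₀~x) = inj₁ (inj₁ (first-neighbour (adj-flip T v₀~x)))

      near-v₁ : ∀ x y → adj T x y ≡ true → Close T (v 1) x → Meets₁ x y
      near-v₁ x y _ (inj₁ v₁≡x) = inj₁ (inj₁ (sym v₁≡x))
      near-v₁ x y x~y (inj₂ v₁~x) with neighbour-of-v (<-lit 1 7) (adj-flip T v₁~x)
      ... | inj₁ (_ , _ , refl , inj₁ refl) = inj₂ (inj₁ (first-neighbour (adj-flip T x~y)))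
      ... | inj₁ (_ , _ , x≡v₂ , inj₂ refl) = inj₁ (inj₂ x≡v₂)
      ... | inj₂ leaf = inj₂ (inj₁ (leafAt-neighbour leaf x~y))

      near-v₆ : ∀ x y → adj T x y ≡ true → Close T (v 6) x → Meets₂ x y
      near-v₆ x y x~y (inj₁ refl) with last-neighbour (adj-flip T x~y)
      ... | 5 , refl , y≡v₅ = inj₂ (inj₂ y≡v₅)
      near-v₆ x y _ (inj₂ v₆~x) with last-neighbour (adj-flip T v₆~x)
      ... | 5 , refl , x≡v₅ = inj₁ (inj₂ x≡v₅)

      near-v₅ : ∀ x y → adj T x y ≡ true → Close T (v 5) x → Meets₂ x y
      near-v₅ x y _ (inj₁ v₅≡x) = inj₁ (inj₂ (sym v₅≡x))
      near-v₅ x y x~y (inj₂ v₅~x) with neighbour-of-v (<-lit 5 7) (adj-flip T v₅~x)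
      ... | inj₁ (_ , _ , x≡v₄ , inj₁ refl) = inj₁ (inj₁ x≡v₄)
      ... | inj₁ (_ , _ , refl , inj₂ refl) = near-v₆ x y x~y (inj₁ refl)
      ... | inj₂ leaf = inj₂ (inj₂ (leafAt-neighbour leaf x~y))

  module _ (K : ℕ) (p : Fin (suc K) → Fin n) (hyp : Hypotheses T (suc K) p) (4≤K : 4 ≤ K) where
    open LongestPath T tree K p hyp

    private
      <5⇒<k : ∀ i → {True (i <ᵇ 5)} → i < k
      <5⇒<k i {i<5} = ≤-trans (<-lit i 5 {i<5}) (s≤s 4≤K)

    -- at-v₅ keeps the edges at v₅ in conflict with the new matching: through v₄ when v₅ is the
    -- last vertex, through v₆v₇ otherwise.
    module Exchange₁ (N : EdgeSet T) (maxN : IsMaximalInducedMatching T N)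
      (v₀v₁∈N : N (v 0) (v 1) ≡ true) (v₃v₄∈N : N (v 3) (v 4) ≡ true)
      (at-v₅ : 5 < k → ∀ w → adj T (v 5) w ≡ true → w ≡ v 4 ⊎ (Σ (7 < k) λ _ → N (v 6) (v 7) ≡ true)) where

      private
        imN = proj₁ maxN
        D₁ = remove T N (v 0) (v 1)
        D₂ = remove T D₁ (v 3) (v 4)

      N′ : EdgeSet T
      N′ = insert T D₂ (v 2) (v 3)

      private
        v₃v₄≠v₀v₁ : ¬ SameEdge T (v 3) (v 4) (v 0) (v 1)
        v₃v₄≠v₀v₁ = v-¬sameEdge (<5⇒<k 3) (<5⇒<k 0) (<5⇒<k 1) (λ ()) (λ ())

        v₂v₃∉N : N (v 2) (v 3) ≡ false
        v₂v₃∉N = trans (IM-sym T imN _ _) (IM-≢⇒∉ T imN v₃v₄∈N (v-≢ (<5⇒<k 2) (<5⇒<k 4) (λ ())))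

        D₂-⊆ : ∀ {x y} → D₂ x y ≡ true → N x y ≡ true × ¬ SameEdge T x y (v 0) (v 1) × ¬ SameEdge T x y (v 3) (v 4)
        D₂-⊆ {x} {y} e = remove-⊆ T N _ _ x y (remove-⊆ T D₁ _ _ x y e) , remove-≢ T N _ _ x y (remove-⊆ T D₁ _ _ x y e) ,
                         remove-≢ T D₁ _ _ x y e

        kept : ∀ {x y} → N x y ≡ true → ¬ SameEdge T x y (v 0) (v 1) → ¬ SameEdge T x y (v 3) (v 4) → N′ x y ≡ true
        kept {x} {y} m ≠₀₁ ≠₃₄ = insert-⊇ T D₂ _ _ x y (remove-keeps T D₁ _ _ x y (remove-keeps T N _ _ x y m ≠₀₁) ≠₃₄)

      N′-size : size T N ≡ suc (size T N′)
      N′-size = begin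
        size T N               ≡⟨ size-remove T N _ _ N-sym v₀v₁∈N (v-≢ (<5⇒<k 0) (<5⇒<k 1) (λ ())) ⟩
        suc (size T D₁)        ≡⟨ cong suc (size-remove T D₁ _ _ D₁-sym (remove-keeps T N _ _ _ _ v₃v₄∈N v₃v₄≠v₀v₁)
                                    (v-≢ (<5⇒<k 3) (<5⇒<k 4) (λ ()))) ⟩
        suc (suc (size T D₂))  ≡⟨ cong suc (sym (size-insert T D₂ _ _ (remove-sym T _ _ D₁-sym)
                                    (cong (λ b → (b ∧ _) ∧ _) v₂v₃∉N) (v-≢ (<5⇒<k 2) (<5⇒<k 3) (λ ())))) ⟩
        suc (size T N′)        ∎
        where
          open ≡-Reasoning
          N-sym = IM-sym T imN
          D₁-sym = remove-sym T _ _ N-sym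

      N′-IM : IsInducedMatching T N′
      N′-IM = IM-insert T (IM-⊆ T imN (remove-sym T _ _ (remove-sym T _ _ (IM-sym T imN))) (λ x y e → proj₁ (D₂-⊆ e)))
                (v-step 2 (<5⇒<k 3)) separated-from-v₂v₃
        where
          far-from-v₂ : ∀ {z z′} → adj T z z′ ≡ true → Far T z (v 1) → Far T z′ (v 1) → Far T z (v 3) → Far T (v 2) z
          far-from-v₂ z~z′ (z≢v₁ , z≁v₁) (_ , z′≁v₁) (z≢v₃ , _) =
            far-from-v (<5⇒<k 2) (v-step⁻ 1 (<5⇒<k 2)) z≁v₁ z′≁v₁ (λ { _ _ (inj₁ refl) → z≢v₁ ; _ _ (inj₂ refl) → z≢v₃ }) z~z′
          separated-from-v₂v₃ : ∀ x y → D₂ x y ≡ true → Separated T (v 2) (v 3) x y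
          separated-from-v₂v₃ x y e with D₂-⊆ e
          ... | m , ≠₀₁ , ≠₃₄
              with separated⇒far T (IM-separated T imN m v₀v₁∈N ≠₀₁)
                 | separated⇒far T (IM-separated T imN m v₃v₄∈N ≠₃₄)
          ...   | (_ , x-v₁ , _ , y-v₁) | (x-v₃ , _ , y-v₃ , _) =
                   separated T (far-from-v₂ (IM-adj T imN m) x-v₁ y-v₁ x-v₃)
                       (far-from-v₂ (adj-flip T (IM-adj T imN m)) y-v₁ x-v₁ y-v₃)
                       (far-sym T x-v₃) (far-sym T y-v₃)

      N′-maximal : IsMaximalInducedMatching T N′
      N′-maximal = maximal-exchange T maxN N′-IM replaced
        where
          via-v₂v₃ : ∀ {w w′} → Conflict T w w′ (v 2) (v 3) → ConflictsWith T N′ w w′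
          via-v₂v₃ c = v 2 , v 3 , insert-new T D₂ _ _ , c

          v₁~v₂ : adj T (v 1) (v 2) ≡ true
          v₁~v₂ = v-step 1 (<5⇒<k 2)
          v₄~v₃ : adj T (v 4) (v 3) ≡ true
          v₄~v₃ = v-step⁻ 3 (<5⇒<k 4)

          near-v₀v₁ : ∀ w w′ → adj T w w′ ≡ true → Near T w (v 0) (v 1) → ConflictsWith T N′ w w′
          near-v₀v₁ w w′ w~w′ (is-left refl) with first-neighbour (adj-flip T w~w′)
          ... | refl = via-v₂v₃ (inj₂ (adj-left v₁~v₂))
          near-v₀v₁ w w′ w~w′ (is-right refl) = via-v₂v₃ (inj₁ (adj-left v₁~v₂))
          near-v₀v₁ w w′ w~w′ (adj-left w~v₀) with first-neighbour w~v₀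
          ... | refl = via-v₂v₃ (inj₁ (adj-left v₁~v₂))
          near-v₀v₁ w w′ w~w′ (adj-right w~v₁) with neighbour-of-v (<5⇒<k 1) w~v₁
          ... | inj₁ (_ , _ , refl , inj₁ refl) = near-v₀v₁ w w′ w~w′ (is-left refl)
          ... | inj₁ (_ , _ , w≡v₂ , inj₂ refl) = via-v₂v₃ (inj₁ (is-left w≡v₂))
          ... | inj₂ leaf with leafAt-neighbour leaf w~w′
          ...   | refl = via-v₂v₃ (inj₂ (adj-left v₁~v₂))

          near-v₃v₄ : ∀ w w′ → adj T w w′ ≡ true → Near T w (v 3) (v 4) → ConflictsWith T N′ w w′
          near-v₃v₄ w w′ w~w′ (is-left w≡v₃) = via-v₂v₃ (inj₁ (is-right w≡v₃))
          near-v₃v₄ w w′ w~w′ (is-right refl) = via-v₂v₃ (inj₁ (adj-right v₄~v₃))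
          near-v₃v₄ w w′ w~w′ (adj-left w~v₃) with neighbour-of-v (<5⇒<k 3) w~v₃
          ... | inj₁ (_ , _ , w≡v₂ , inj₁ refl) = via-v₂v₃ (inj₁ (is-left w≡v₂))
          ... | inj₁ (_ , _ , refl , inj₂ refl) = via-v₂v₃ (inj₁ (adj-right v₄~v₃))
          ... | inj₂ leaf = via-v₂v₃ (inj₂ (is-right (leafAt-neighbour leaf w~w′)))
          near-v₃v₄ w w′ w~w′ (adj-right w~v₄) with neighbour-of-v (<5⇒<k 4) w~v₄
          ... | inj₁ (_ , _ , w≡v₃ , inj₁ refl) = via-v₂v₃ (inj₁ (is-right w≡v₃))
          ... | inj₂ leaf with leafAt-neighbour leaf w~w′
          ...   | refl = via-v₂v₃ (inj₂ (adj-right v₄~v₃))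
          near-v₃v₄ w w′ w~w′ (adj-right w~v₄) | inj₁ (_ , 5<k , refl , inj₂ refl) with at-v₅ 5<k w′ w~w′
          ... | inj₁ refl = via-v₂v₃ (inj₂ (adj-right v₄~v₃))
          ... | inj₂ (7<k , v₆v₇∈N) = v 6 , v 7 , kept v₆v₇∈N (v-¬sameEdge 6<k 0<k 1<k (λ ()) (λ ()))
                (v-¬sameEdge 6<k 3<k 4<k (λ ()) (λ ())) ,
                                      inj₁ (adj-left (v-step 5 6<k))
            where
              6<k : 6 < k
              6<k = <-trans (n<1+n 6) 7<k
              0<k = <5⇒<k 0
              1<k = <5⇒<k 1
              3<k = <5⇒<k 3
              4<k = <5⇒<k 4

          replaced : ∀ x y → N x y ≡ true → N′ x y ≡ true ⊎
              (∀ u w → adj T u w ≡ true → Conflict T u w x y → ConflictsWith T N′ u w)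
          replaced x y m with sameEdge? T x y (v 0) (v 1) | sameEdge? T x y (v 3) (v 4)
          ... | yes s | _ = inj₂ λ u w u~w c → conflictsWith-if-near T near-v₀v₁ u w u~w (conflict-sameEdge T c s)
          ... | no _ | yes s = inj₂ λ u w u~w c → conflictsWith-if-near T near-v₃v₄ u w u~w (conflict-sameEdge T c s)
          ... | no ≠₀₁ | no ≠₃₄ = inj₁ (kept m ≠₀₁ ≠₃₄)

    private
      exchange-from : ∀ C → IsInducedMatching T (edgesOf T C) → (v 0 , v 1) ∈ C → (v 3 , v 4) ∈ C →
        (5 < k → ∀ w → adj T (v 5) w ≡ true → w ≡ v 4 ⊎ (Σ (7 < k) λ _ → (v 6 , v 7) ∈ C)) → ¬ WellIndumatched T
      exchange-from C C-IM v₀v₁∈C v₃v₄∈C at-v₅ with extend-to-maximal T (edgesOf T C) C-IM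
      ... | N , maxN , C⊆N = ¬wellIndumatched T maxN N′-maximal N′-size
        where
          in-N : ∀ {a b} → (a , b) ∈ C → N a b ≡ true
          in-N ab∈C = C⊆N _ _ (edgesOf-complete T ab∈C)
          open Exchange₁ N maxN (in-N v₀v₁∈C) (in-N v₃v₄∈C)
            (λ 5<k w v₅~w → map₂ (λ (7<k , v₆v₇∈C) → 7<k , in-N v₆v₇∈C) (at-v₅ 5<k w v₅~w))

    ¬wellIndumatched-long : (5 < k → ∀ w → adj T (v 5) w ≡ true → w ≡ v 4) ⊎ 7 < k → ¬ WellIndumatched T
    ¬wellIndumatched-long (inj₁ v₅-last) =
      exchange-from ((v 0 , v 1) ∷ (v 3 , v 4) ∷ [])
        (IM-edgesOf T (v-step 0 (<5⇒<k 1) ∷ v-step 3 (<5⇒<k 4) ∷ [])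
            ((v-edges-separated (<-lit 2 3) (<5⇒<k 4) ∷ []) ∷ [] ∷ []))
        (here refl) (there (here refl)) (λ 5<k w v₅~w → inj₁ (v₅-last 5<k w v₅~w))
    ¬wellIndumatched-long (inj₂ 7<k) =
      exchange-from ((v 0 , v 1) ∷ (v 3 , v 4) ∷ (v 6 , v 7) ∷ [])
        (IM-edgesOf T (v-step 0 (<5⇒<k 1) ∷ v-step 3 (<5⇒<k 4) ∷ v-step 6 7<k ∷ [])
          ((v-edges-separated (<-lit 2 3) (<5⇒<k 4) ∷ v-edges-separated (<-lit 2 6) 7<k ∷ []) ∷
           (v-edges-separated (<-lit 5 6) 7<k ∷ []) ∷ [] ∷ []))
        (here refl) (there (here refl)) (λ _ _ _ → inj₂ (7<k , there (there (here refl))))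

  module _ (p : Fin 7 → Fin n) (hyp : Hypotheses T 7 p) (deg-v₃≡3 : deg T (LongestPath.v T tree 6 p hyp 3) ≡ 3) where
    open LongestPath T tree 6 p hyp

    private
      ℓ : Fin n
      ℓ = proj₁ (pendant-leaf 1 (<-lit 5 7) deg-v₃≡3)

      ℓ-leaf : LeafAt ℓ 3
      ℓ-leaf = proj₂ (pendant-leaf 1 (<-lit 5 7) deg-v₃≡3)

      v₃~ℓ : adj T (v 3) ℓ ≡ true
      v₃~ℓ = adj-flip T (proj₂ (proj₂ ℓ-leaf))

      ℓ-far : ∀ b → {True (b <ᵇ 7)} → b ≢ 3 → Far T ℓ (v b)
      ℓ-far b {b<7} = leafAt-far ℓ-leaf (<-lit b 7 {b<7})

    module Exchange₂ (N : EdgeSet T) (maxN : IsMaximalInducedMatching T N)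
      (v₀v₁∈N : N (v 0) (v 1) ≡ true) (v₃ℓ∈N : N (v 3) ℓ ≡ true) (v₅v₆∈N : N (v 5) (v 6) ≡ true) where

      private
        imN = proj₁ maxN
        D₁ = remove T N (v 0) (v 1)
        D₂ = remove T D₁ (v 3) ℓ
        D₃ = remove T D₂ (v 5) (v 6)
        E = insert T D₃ (v 1) (v 2)

      N′ : EdgeSet T
      N′ = insert T E (v 4) (v 5)

      private
        D₃-⊆ : ∀ {x y} → D₃ x y ≡ true →
          N x y ≡ true × ¬ SameEdge T x y (v 0) (v 1) × ¬ SameEdge T x y (v 3) ℓ × ¬ SameEdge T x y (v 5) (v 6)
        D₃-⊆ {x} {y} e = remove-⊆ T N _ _ x y in-D₁ , remove-≢ T N _ _ x y in-D₁ , remove-≢ T D₁ _ _ x y in-D₂ ,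
            remove-≢ T D₂ _ _ x y e
          where
            in-D₂ = remove-⊆ T D₂ _ _ x y e
            in-D₁ = remove-⊆ T D₁ _ _ x y in-D₂

        kept : ∀ {x y} → N x y ≡ true → ¬ SameEdge T x y (v 0) (v 1) → ¬ SameEdge T x y (v 3) ℓ →
          ¬ SameEdge T x y (v 5) (v 6) →
          N′ x y ≡ true
        kept {x} {y} m ≠₀₁ ≠₃ℓ ≠₅₆ = insert-⊇ T E _ _ x y (insert-⊇ T D₃ _ _ x y
          (remove-keeps T D₂ _ _ x y (remove-keeps T D₁ _ _ x y (remove-keeps T N _ _ x y m ≠₀₁) ≠₃ℓ) ≠₅₆))

        v₃ℓ≠v₀v₁ : ¬ SameEdge T (v 3) ℓ (v 0) (v 1)
        v₃ℓ≠v₀v₁ = v-¬sameEdge (<-lit 3 7) (<-lit 0 7) (<-lit 1 7) (λ ()) (λ ())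

        v₅v₆≠v₀v₁ : ¬ SameEdge T (v 5) (v 6) (v 0) (v 1)
        v₅v₆≠v₀v₁ = v-¬sameEdge (<-lit 5 7) (<-lit 0 7) (<-lit 1 7) (λ ()) (λ ())

        v₅v₆≠v₃ℓ : ¬ SameEdge T (v 5) (v 6) (v 3) ℓ
        v₅v₆≠v₃ℓ (inj₁ (e , _)) = v-≢ (<-lit 5 7) (<-lit 3 7) (λ ()) e
        v₅v₆≠v₃ℓ (inj₂ (e , _)) = proj₁ (ℓ-far 5 (λ ())) (sym e)

        v₁v₂∉D₃ : D₃ (v 1) (v 2) ≡ false
        v₁v₂∉D₃ = cong (λ b → ((b ∧ _) ∧ _) ∧ _)
          (IM-≢⇒∉ T imN (trans (IM-sym T imN _ _) v₀v₁∈N) (v-≢ (<-lit 2 7) (<-lit 0 7) (λ ())))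

        v₄v₅∉E : E (v 4) (v 5) ≡ false
        v₄v₅∉E = cong₂ _∨_ (cong (λ b → ((b ∧ _) ∧ _) ∧ _) v₄v₅∉N)
                   (⟦⟧-false T (v 1) (v 2) (v 4) (v 5) (v-¬sameEdge (<-lit 4 7) (<-lit 1 7) (<-lit 2 7) (λ ()) (λ ())))
          where
            v₄v₅∉N : N (v 4) (v 5) ≡ false
            v₄v₅∉N = trans (IM-sym T imN _ _) (IM-≢⇒∉ T imN v₅v₆∈N (v-≢ (<-lit 4 7) (<-lit 6 7) (λ ())))

      N′-size : size T N ≡ suc (size T N′)
      N′-size = begin
        size T N                     ≡⟨ size-remove T N _ _ (IM-sym T imN) v₀v₁∈N (v-≢ (<-lit 0 7) (<-lit 1 7) (λ ())) ⟩
        suc (size T D₁)              ≡⟨ cong suc (size-remove T D₁ _ _ D₁-sym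
                                          (remove-keeps T N _ _ _ _ v₃ℓ∈N v₃ℓ≠v₀v₁) (adj⇒≢ T v₃~ℓ)) ⟩
        suc (suc (size T D₂))        ≡⟨ cong (suc ∘ suc) (size-remove T D₂ _ _ D₂-sym
                                          (remove-keeps T D₁ _ _ _ _ (remove-keeps T N _ _ _ _ v₅v₆∈N v₅v₆≠v₀v₁) v₅v₆≠v₃ℓ)
                                          (v-≢ (<-lit 5 7) (<-lit 6 7) (λ ()))) ⟩
        suc (suc (suc (size T D₃)))  ≡⟨ cong (suc ∘ suc) (sym (size-insert T D₃ _ _ D₃-sym
                                          v₁v₂∉D₃ (v-≢ (<-lit 1 7) (<-lit 2 7) (λ ())))) ⟩
        suc (suc (size T E))         ≡⟨ cong suc (sym (size-insert T E _ _ (insert-sym T _ _ D₃-sym)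
                                          v₄v₅∉E (v-≢ (<-lit 4 7) (<-lit 5 7) (λ ())))) ⟩
        suc (size T N′)              ∎
        where
          open ≡-Reasoning
          D₁-sym = remove-sym T _ _ (IM-sym T imN)
          D₂-sym = remove-sym T _ _ D₁-sym
          D₃-sym = remove-sym T _ _ D₂-sym

      N′-IM : IsInducedMatching T N′
      N′-IM = IM-insert T (IM-insert T (IM-⊆ T imN D₃-sym (λ x y e → proj₁ (D₃-⊆ e)))
                              (v-step 1 (<-lit 2 7)) separated-from-v₁v₂)
                (v-step 4 (<-lit 5 7)) separated-from-v₄v₅
        where
          D₃-sym = remove-sym T _ _ (remove-sym T _ _ (remove-sym T _ _ (IM-sym T imN)))

          separated-from-v₁v₂ : ∀ x y → D₃ x y ≡ true → Separated T (v 1) (v 2) x y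
          separated-from-v₁v₂ x y e with D₃-⊆ e
          ... | m , ≠₀₁ , ≠₃ℓ , _
              with separated⇒far T (IM-separated T imN m v₀v₁∈N ≠₀₁)
                 | separated⇒far T (IM-separated T imN m v₃ℓ∈N ≠₃ℓ)
          ...   | (_ , x-v₁ , _ , y-v₁) | ((x≢v₃ , _) , _ , (y≢v₃ , _) , _) =
                   separated T (far-sym T x-v₁) (far-sym T y-v₁) (far-from-v₂ (IM-adj T imN m) x-v₁ y-v₁ x≢v₃)
                       (far-from-v₂ (adj-flip T (IM-adj T imN m)) y-v₁ x-v₁ y≢v₃)
            where
              far-from-v₂ : ∀ {z z′} → adj T z z′ ≡ true → Far T z (v 1) → Far T z′ (v 1) → z ≢ v 3 → Far T (v 2) z
              far-from-v₂ z~z′ (z≢v₁ , z≁v₁) (_ , z′≁v₁) z≢v₃ =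
                far-from-v (<-lit 2 7) (v-step⁻ 1 (<-lit 2 7)) z≁v₁ z′≁v₁
                    (λ { _ _ (inj₁ refl) → z≢v₁ ; _ _ (inj₂ refl) → z≢v₃ }) z~z′

          separated-from-v₄v₅ : ∀ x y → E x y ≡ true → Separated T (v 4) (v 5) x y
          separated-from-v₄v₅ x y e with insert-cases T D₃ _ _ x y e
          ... | inj₂ same = separated-sym T (separated-sameEdge T same (v-edges-separated (<-lit 3 4) (<-lit 5 7)))
          ... | inj₁ d with D₃-⊆ d
          ...   | m , _ , ≠₃ℓ , ≠₅₆
              with separated⇒far T (IM-separated T imN m v₅v₆∈N ≠₅₆)
                 | separated⇒far T (IM-separated T imN m v₃ℓ∈N ≠₃ℓ)
          ...     | (x-v₅ , _ , y-v₅ , _) | ((x≢v₃ , _) , _ , (y≢v₃ , _) , _) =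
                     separated T (far-from-v₄ (IM-adj T imN m) x-v₅ y-v₅ x≢v₃)
                         (far-from-v₄ (adj-flip T (IM-adj T imN m)) y-v₅ x-v₅ y≢v₃)
                         (far-sym T x-v₅) (far-sym T y-v₅)
            where
              far-from-v₄ : ∀ {z z′} → adj T z z′ ≡ true → Far T z (v 5) → Far T z′ (v 5) → z ≢ v 3 → Far T (v 4) z
              far-from-v₄ z~z′ (z≢v₅ , z≁v₅) (_ , z′≁v₅) z≢v₃ =
                far-from-v (<-lit 4 7) (v-step 4 (<-lit 5 7)) z≁v₅ z′≁v₅
                    (λ { _ _ (inj₁ refl) → z≢v₃ ; _ _ (inj₂ refl) → z≢v₅ }) z~z′

      N′-maximal : IsMaximalInducedMatching T N′
      N′-maximal = maximal-exchange T maxN N′-IM replaced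
        where
          via-v₁v₂ : ∀ {w w′} → Conflict T w w′ (v 1) (v 2) → ConflictsWith T N′ w w′
          via-v₁v₂ c = v 1 , v 2 , insert-⊇ T E _ _ _ _ (insert-new T D₃ _ _) , c
          via-v₄v₅ : ∀ {w w′} → Conflict T w w′ (v 4) (v 5) → ConflictsWith T N′ w w′
          via-v₄v₅ c = v 4 , v 5 , insert-new T E _ _ , c

          v₃~v₂ : adj T (v 3) (v 2) ≡ true
          v₃~v₂ = v-step⁻ 2 (<-lit 3 7)
          v₆~v₅ : adj T (v 6) (v 5) ≡ true
          v₆~v₅ = v-step⁻ 5 (<-lit 6 7)

          near-v₀v₁ : ∀ w w′ → adj T w w′ ≡ true → Near T w (v 0) (v 1) → ConflictsWith T N′ w w′
          near-v₀v₁ w w′ w~w′ (is-left refl) = via-v₁v₂ (inj₂ (is-left (first-neighbour (adj-flip T w~w′))))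
          near-v₀v₁ w w′ w~w′ (is-right w≡v₁) = via-v₁v₂ (inj₁ (is-left w≡v₁))
          near-v₀v₁ w w′ w~w′ (adj-left w~v₀) = via-v₁v₂ (inj₁ (is-left (first-neighbour w~v₀)))
          near-v₀v₁ w w′ w~w′ (adj-right w~v₁) = via-v₁v₂ (inj₁ (adj-left w~v₁))

          near-v₃ℓ : ∀ w w′ → adj T w w′ ≡ true → Near T w (v 3) ℓ → ConflictsWith T N′ w w′
          near-v₃ℓ w w′ w~w′ (is-left refl) = via-v₁v₂ (inj₁ (adj-right v₃~v₂))
          near-v₃ℓ w w′ w~w′ (is-right refl) with leafAt-neighbour ℓ-leaf w~w′
          ... | refl = via-v₁v₂ (inj₂ (adj-right v₃~v₂))
          near-v₃ℓ w w′ w~w′ (adj-left w~v₃) with neighbour-of-v (<-lit 3 7) w~v₃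
          ... | inj₁ (_ , _ , w≡v₂ , inj₁ refl) = via-v₁v₂ (inj₁ (is-right w≡v₂))
          ... | inj₁ (_ , _ , w≡v₄ , inj₂ refl) = via-v₄v₅ (inj₁ (is-left w≡v₄))
          ... | inj₂ leaf with leafAt-neighbour leaf w~w′
          ...   | refl = via-v₁v₂ (inj₂ (adj-right v₃~v₂))
          near-v₃ℓ w w′ w~w′ (adj-right w~ℓ) with leafAt-neighbour ℓ-leaf (adj-flip T w~ℓ)
          ... | refl = via-v₁v₂ (inj₁ (adj-right v₃~v₂))

          near-v₅v₆ : ∀ w w′ → adj T w w′ ≡ true → Near T w (v 5) (v 6) → ConflictsWith T N′ w w′
          near-v₅v₆ w w′ w~w′ (is-left w≡v₅) = via-v₄v₅ (inj₁ (is-right w≡v₅))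
          near-v₅v₆ w w′ w~w′ (is-right refl) = via-v₄v₅ (inj₁ (adj-right v₆~v₅))
          near-v₅v₆ w w′ w~w′ (adj-left w~v₅) with neighbour-of-v (<-lit 5 7) w~v₅
          ... | inj₁ (_ , _ , w≡v₄ , inj₁ refl) = via-v₄v₅ (inj₁ (is-left w≡v₄))
          ... | inj₁ (_ , _ , refl , inj₂ refl) = via-v₄v₅ (inj₁ (adj-right v₆~v₅))
          ... | inj₂ leaf = via-v₄v₅ (inj₂ (is-right (leafAt-neighbour leaf w~w′)))
          near-v₅v₆ w w′ w~w′ (adj-right w~v₆) with last-neighbour w~v₆
          ... | 5 , refl , w≡v₅ = via-v₄v₅ (inj₁ (is-right w≡v₅))

          replaced : ∀ x y → N x y ≡ true → N′ x y ≡ true ⊎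
              (∀ u w → adj T u w ≡ true → Conflict T u w x y → ConflictsWith T N′ u w)
          replaced x y m with sameEdge? T x y (v 0) (v 1) | sameEdge? T x y (v 3) ℓ | sameEdge? T x y (v 5) (v 6)
          ... | yes s | _ | _ = inj₂ λ u w u~w c → conflictsWith-if-near T near-v₀v₁ u w u~w (conflict-sameEdge T c s)
          ... | no _ | yes s | _ = inj₂ λ u w u~w c → conflictsWith-if-near T near-v₃ℓ u w u~w (conflict-sameEdge T c s)
          ... | no _ | no _ | yes s = inj₂ λ u w u~w c → conflictsWith-if-near T near-v₅v₆ u w u~w (conflict-sameEdge T c s)
          ... | no ≠₀₁ | no ≠₃ℓ | no ≠₅₆ = inj₁ (kept m ≠₀₁ ≠₃ℓ ≠₅₆)

    ¬wellIndumatched-seven : ¬ WellIndumatched T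
    ¬wellIndumatched-seven = from (extend-to-maximal T (edgesOf T C) C-IM)
      where
        C : List (Fin n × Fin n)
        C = (v 0 , v 1) ∷ (v 3 , ℓ) ∷ (v 5 , v 6) ∷ []
        C-IM : IsInducedMatching T (edgesOf T C)
        C-IM = IM-edgesOf T (v-step 0 (<-lit 1 7) ∷ v₃~ℓ ∷ v-step 5 (<-lit 6 7) ∷ [])
                 ((separated T (v-far (<-lit 1 3) (<-lit 3 7)) (far-sym T (ℓ-far 0 (λ ())))
                     (v-far (<-lit 2 3) (<-lit 3 7)) (far-sym T (ℓ-far 1 (λ ()))) ∷
                   v-edges-separated (<-lit 2 5) (<-lit 6 7) ∷ []) ∷
                  (separated T (v-far (<-lit 4 5) (<-lit 5 7)) (v-far (<-lit 4 6) (<-lit 6 7)) (ℓ-far 5 (λ ()))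
                      (ℓ-far 6 (λ ())) ∷ []) ∷ [] ∷ [])
        from : (Σ (EdgeSet T) λ N → IsMaximalInducedMatching T N × _⊆ₑ_ T (edgesOf T C) N) → ¬ WellIndumatched T
        from (N , maxN , C⊆N) = ¬wellIndumatched T maxN N′-maximal N′-size
          where
            open Exchange₂ N maxN (C⊆N _ _ (edgesOf-complete T {C} (here refl)))
              (C⊆N _ _ (edgesOf-complete T {C} (there (here refl))))
              (C⊆N _ _ (edgesOf-complete T {C} (there (there (here refl)))))

  private
    2≤d≤3 : ∀ {d} → 2 ≤ d → d ≤ 3 → d ≡ 2 ⊎ d ≡ 3
    2≤d≤3 {0} () _
    2≤d≤3 {1} (s≤s ()) _
    2≤d≤3 {2} _ _ = inj₁ refl
    2≤d≤3 {3} _ _ = inj₂ refl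
    2≤d≤3 {suc (suc (suc (suc _)))} _ (s≤s (s≤s (s≤s ())))

  wellIndumatched⇒ : ∀ K p (hyp : Hypotheses T (suc K) p) → WellIndumatched T →
    (1 ≤ suc K × suc K ≤ 4) ⊎ (suc K ≡ 7 × (∀ (i : Fin (suc K)) → toℕ i ≡ 3 → deg T (p i) ≡ 2))
  wellIndumatched⇒ 0 p hyp wi = inj₁ (s≤s z≤n , s≤s z≤n)
  wellIndumatched⇒ 1 p hyp wi = inj₁ (s≤s z≤n , <-lit 1 4)
  wellIndumatched⇒ 2 p hyp wi = inj₁ (s≤s z≤n , <-lit 2 4)
  wellIndumatched⇒ 3 p hyp wi = inj₁ (s≤s z≤n , ≤-refl)
  wellIndumatched⇒ 4 p hyp wi = ⊥-elim (¬wellIndumatched-long 4 p hyp ≤-refl (inj₁ λ 5<5 → ⊥-elim (1+n≰n 5<5)) wi)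
  wellIndumatched⇒ 5 p hyp wi = ⊥-elim (¬wellIndumatched-long 5 p hyp (n≤1+n 4) (inj₁ v₅-last) wi)
    where
      open LongestPath T tree 5 p hyp
      v₅-last : 5 < 6 → ∀ w → adj T (v 5) w ≡ true → w ≡ v 4
      v₅-last _ w v₅~w with last-neighbour (adj-flip T v₅~w)
      ... | 4 , refl , w≡v₄ = w≡v₄
  wellIndumatched⇒ 6 p hyp wi with 2≤d≤3 (2≤deg-inner 2 (<-lit 4 7)) (deg-v≤3 (<-lit 3 7))
    where open LongestPath T tree 6 p hyp
  ... | inj₁ deg≡2 = inj₂ (refl , λ i i≡3 → subst (λ j → deg T (p j) ≡ 2) (sym (toℕ-injective i≡3)) deg≡2)
  ... | inj₂ deg≡3 = ⊥-elim (¬wellIndumatched-seven p hyp deg≡3 wi)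
  wellIndumatched⇒ (suc (suc (suc (suc (suc (suc (suc K))))))) p hyp wi =
    ⊥-elim (¬wellIndumatched-long _ p hyp (s≤s (s≤s (s≤s (s≤s z≤n))))
        (inj₂ (s≤s (s≤s (s≤s (s≤s (s≤s (s≤s (s≤s (s≤s z≤n))))))))) wi)

  ⇒wellIndumatched : ∀ K p (hyp : Hypotheses T (suc K) p) →
    (1 ≤ suc K × suc K ≤ 4) ⊎ (suc K ≡ 7 × (∀ (i : Fin (suc K)) → toℕ i ≡ 3 → deg T (p i) ≡ 2)) → WellIndumatched T
  ⇒wellIndumatched K p hyp (inj₁ (_ , k≤4)) = short-wellIndumatched K p hyp (≤-pred k≤4)
  ⇒wellIndumatched 6 p hyp (inj₂ (_ , deg≡2)) = seven-wellIndumatched p hyp (deg≡2 (fromℕ< (<-lit 3 7)) refl)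

single-vertex-path : ∀ {n} (G : Graph n) x → IsPath G 1 (λ _ → x)
single-vertex-path G x = (λ { {fzero} {fzero} _ → refl }) , λ { fzero fzero () }

lemma3p1 : (n : ℕ) (T : Graph n) → IsTree T →
    (k : ℕ) (p : Fin k → Fin n) → IsLongestPath T k p →
    (∀ (i : Fin k) → deg T (p i) ≤ 3) →
    (∀ (i : Fin k) → deg T (p i) ≡ 3 →
       ∃[ u ] IsPendantEdge T (p i) u) →
    WellIndumatched T ⇔
      ((1 ≤ k × k ≤ 4) ⊎ (k ≡ 7 × (∀ (i : Fin k) → toℕ i ≡ 3 → deg T (p i) ≡ 2)))
lemma3p1 n T tree zero p (_ , longest) _ _ = ⊥-elim (1+n≰n (longest 1 _ (single-vertex-path T (fromℕ< (proj₁ tree)))))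
lemma3p1 n T tree (suc K) p longest deg≤3 pendant =
  mk⇔ (wellIndumatched⇒ {T = T} tree K p (longest , deg≤3 , pendant))
      (⇒wellIndumatched {T = T} tree K p (longest , deg≤3 , pendant))
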